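{- Let $k,r$ be integers with $k\ge r\ge1$ and let $m\ge1$. For $j\ge1$, \[ g_{k,r}(m,\overline{k(j-1)+r})=q^{m-j+k{j\choose 2}+rj}{{m-j+k(j-1)+r-1}\brack{k(j-1)+r-1}}_1. \] For $j=1$ and $1\le s\le r$, or for $j\ge2$ and $-k+r+1\le s\le r$, \[ g_{k,r}(m,k(j-1)+s)=q^{m-j+k{j\choose 2}+r(j-1)+s}{{m-j+k(j-1)+s-1}\brack{k(j-1)+s-1}}_1. \]
   Context: Overpartitions: partitions in which the first occurrence of each part size may be overlined; parts are ordered $1<\bar1<2<\bar2<\cdots$ and listed non-increasingly. For $m\ge1$, $\mathcal{B}_{k,r}(m)$ is the set of overpartitions $\lambda=(\lambda_1,\ldots,\lambda_m)$ such that: only parts congruent to $r$ mod $k$ may be overlined; $\lambda_m\le\bar r$; and for $1\le i<m$ and every integer $j\ge0$, if $\overline{k(j-1)+r}\le\lambda_{i+1}\le kj+r$ then $\lambda_i\le\overline{kj+r}$ (for $j=0$ the lower bound is vacuous, i.e. $\lambda_{i+1}\le r$ implies $\lambda_i\le\bar r$). For $l$ a positive integer, $g_{k,r}(m,l)$ (resp. $g_{k,r}(m,\bar l)$) is $\sum q^{|\lambda|}$ over $\lambda\in\mathcal{B}_{k,r}(m)$ whose largest part $\lambda_1$ equals the non-overlined part $l$ (resp. the overlined part $\bar l$), where $|\lambda|$ is the sum of parts. ${A\brack B}_1=\frac{(q;q)_A}{(q;q)_B(q;q)_{A-B}}$ if $A\ge B\ge0$ and $0$ otherwise, with $(q;q)_n=\prod_{i=1}^n(1-q^i)$.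 -}

module Defs where

open import Data.Bool using (Bool; true; false; _∧_; _∨_; not; if_then_else_)
open import Data.Nat as ℕ using (ℕ; zero; suc; _+_; _*_; _∸_; _≡ᵇ_; _≤ᵇ_; ⌊_/2⌋)
open import Data.Nat.DivMod using (_%_)
open import Data.List using (List; []; _∷_; map; foldr; upTo; filter; length; concatMap)
open import Data.Integer as ℤ using (ℤ; +_; -_; ∣_∣)
open import Data.Product using (Σ; _×_; _,_)
open import Relation.Nullary using (¬_)
open import Relation.Binary.PropositionalEquality using (_≡_)
open import Relation.Nullary.Decidable using (⌊_⌋)
open import Data.Nat.Properties using (_≟_)
open import Data.Bool.Properties using (T?)

-- Encoding of overpartition parts as natural-number codes:
--   non-overlined part x  ↦  2x,   overlined part x̄  ↦  2x+1.
-- The paper's order 1 < 1̄ < 2 < 2̄ < ⋯ is then the usual order on codes.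

plain : ℕ → ℕ
plain x = 2 * x

over : ℕ → ℕ
over x = suc (2 * x)

value : ℕ → ℕ
value c = ⌊ c /2⌋

isOver : ℕ → Bool
isOver c = c % 2 ≡ᵇ 1

modℕ : ℕ → ℕ → ℕ
modℕ zero    x = x
modℕ (suc k) x = x % suc k

pairs : List ℕ → List (ℕ × ℕ)
pairs (a ∷ b ∷ xs) = (a , b) ∷ pairs (b ∷ xs)
pairs _            = []

lastOf : List ℕ → ℕ → ℕ
lastOf []       d = d
lastOf (x ∷ []) d = x
lastOf (x ∷ xs) d = lastOf xs d

allᵇ : {A : Set} → (A → Bool) → List A → Bool
allᵇ p = foldr (λ x b → p x ∧ b) true

_⇒ᵇ_ : Bool → Bool → Bool
a ⇒ᵇ b = not a ∨ b

-- "if  over(k(j-1)+r) ≤ b ≤ plain(kj+r)  then  a ≤ over(kj+r)"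
-- (for j = 0 the lower bound is vacuous).  Only j ≤ b can have a
-- satisfied hypothesis, so checking j = 0,…,b covers every j ≥ 0.
jCond : ℕ → ℕ → ℕ → ℕ → ℕ → Bool
jCond k r a b j =
  ((if j ≡ᵇ 0 then true else over (k * (j ∸ 1) + r) ≤ᵇ b)
     ∧ (b ≤ᵇ plain (k * j + r)))
  ⇒ᵇ (a ≤ᵇ over (k * j + r))

pairOK : ℕ → ℕ → ℕ × ℕ → Bool
pairOK k r (a , b) =
  (b ≤ᵇ a)
  ∧ not (isOver b ∧ (a ≡ᵇ b))                -- only first occurrence overlined
  ∧ allᵇ (jCond k r a b) (upTo (suc b))

partOK : ℕ → ℕ → ℕ → Bool
partOK k r c =
  (1 ≤ᵇ value c)
  ∧ (isOver c ⇒ᵇ (modℕ k (value c) ≡ᵇ modℕ k r))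

inB : ℕ → ℕ → ℕ → List ℕ → Bool
inB k r m xs =
  (length xs ≡ᵇ m)
  ∧ allᵇ (partOK k r) xs
  ∧ (lastOf xs 0 ≤ᵇ over r)
  ∧ allᵇ (pairOK k r) (pairs xs)

size : List ℕ → ℕ
size xs = foldr (λ c s → value c + s) 0 xs

headIs : ℕ → List ℕ → Bool
headIs L []      = false
headIs L (x ∷ _) = x ≡ᵇ L

lists : ℕ → ℕ → List (List ℕ)
lists zero    L = [] ∷ []
lists (suc m) L = concatMap (λ c → map (c ∷_) (lists m L)) (upTo (suc L))

-- number of λ ∈ B_{k,r}(m) with largest part (code) L and |λ| = n
-- (every such λ has all codes ≤ L, so the enumeration is exhaustive)
gCount : ℕ → ℕ → ℕ → ℕ → ℕ → ℕ
gCount k r m L n =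
  length (filter (λ xs → T? (inB k r m xs ∧ headIs L xs ∧ (size xs ≡ᵇ n)))
                 (lists m L))

Series : Set
Series = ℕ → ℤ

sumℤ : List ℤ → ℤ
sumℤ = foldr ℤ._+_ (+ 0)

_⊛_ : Series → Series → Series
(f ⊛ g) t = sumℤ (map (λ i → f i ℤ.* g (t ∸ i)) (upTo (suc t)))

infixl 7 _⊛_

qpow : ℕ → Series
qpow e t = if t ≡ᵇ e then + 1 else + 0

zeroS : Series
zeroS _ = + 0

-- 1 - q^i  (used for i ≥ 1)
oneMinusQ : ℕ → Series
oneMinusQ i t = if t ≡ᵇ 0 then + 1 else (if t ≡ᵇ i then - (+ 1) else + 0)

poch : ℕ → Series
poch zero    = qpow 0
poch (suc n) = poch n ⊛ oneMinusQ (suc n)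

_≈S_ : Series → Series → Set
f ≈S g = ∀ t → f t ≡ g t

gPlain : ℕ → ℕ → ℕ → ℕ → Series
gPlain k r m l n = + gCount k r m (plain l) n

gOver : ℕ → ℕ → ℕ → ℕ → Series
gOver k r m l n = + gCount k r m (over l) n

-- "f = q^e · [A brack B]_1"  (A, B, e integers).
-- If A ≥ B ≥ 0 the bracket is (q;q)_A / ((q;q)_B (q;q)_{A-B}); the identity
-- is stated cross-multiplied (and e must be a nonnegative integer n).
-- Otherwise the bracket is 0, so f = 0.
IsQPowBracket : Series → ℤ → ℤ → ℤ → Set
IsQPowBracket f e A B =
  ((+ 0 ℤ.≤ B) → (B ℤ.≤ A) →
     Σ ℕ (λ n → (e ≡ + n) ×
       ((f ⊛ poch ∣ B ∣ ⊛ poch ∣ A ℤ.- B ∣) ≈S (qpow n ⊛ poch ∣ A ∣))))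
  × (¬ ((+ 0 ℤ.≤ B) × (B ℤ.≤ A)) → f ≈S zeroS)

-- Removing the largest part L of a partition in B_{k,r}(m+1) leaves a partition in B_{k,r}(m) whose largest
-- part y may be any code of L's block up to L (except L itself when L is overlined), while the defining
-- condition excludes every lower block. So g_{k,r}(m+1, L) = q^{|L|} Σ_y g_{k,r}(m, y). By induction on m this
-- recursion is solved by q^S times the generating function of partitions into exactly m - j parts of size at
-- most N: summing over a block telescopes by the q-Pascal rule, and every overlined residue k i + r̄ at the
-- start of a block contributes k i + r to the staircase exponent S. Partitions into exactly b parts of size at
-- most N + 1 are counted by q^b [N+b, b], which gives both formulas.

module Submission where

open import Data.Nat using (ℕ; _≤_)

module SeriesAlgebra where

  open import Defs using (Series; _⊛_; sumℤ; qpow; zeroS; oneMinusQ; _≈S_)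
  open import Algebra.Bundles using (CommutativeMonoid)
  open import Data.Bool using (true; false)
  open import Data.Integer using (ℤ; +_; -_; _+_; _*_)
  import Data.Integer.Properties as ℤ
  open import Data.Integer.Tactic.RingSolver using (solve-∀)
  open import Data.List.Properties using (map-upTo; map-applyUpTo)
  open import Data.Nat using (ℕ; zero; suc; _∸_; _≡ᵇ_) renaming (_+_ to _ℕ+_)
  import Data.Nat.Properties as ℕ
  open import Data.Product using (_,_)
  open import Function using (_∘_)
  open import Relation.Binary.Bundles using (Setoid)
  import Relation.Binary.Reasoning.Setoid
  open import Relation.Binary.PropositionalEquality

  tail : Series → Series
  tail f = f ∘ suc

  _⊕_ : Series → Series → Series
  (f ⊕ g) t = f t + g t

  infixl 6 _⊕_

  scale : ℤ → Series → Series
  scale c f t = c * f t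

  ≈-setoid : Setoid _ _
  ≈-setoid = record
    { Carrier       = Series
    ; _≈_           = _≈S_
    ; isEquivalence = record
      { refl  = λ _ → refl
      ; sym   = λ f≈g t → sym (f≈g t)
      ; trans = λ f≈g g≈h t → trans (f≈g t) (g≈h t)
      }
    }

  open Setoid ≈-setoid public
    using () renaming (refl to ≈-refl; sym to ≈-sym; trans to ≈-trans)

  module ≈-Reasoning = Relation.Binary.Reasoning.Setoid ≈-setoid

  ⊛-zero : ∀ f g → (f ⊛ g) 0 ≡ f 0 * g 0
  ⊛-zero f g = ℤ.+-identityʳ _

  ⊛-suc : ∀ f g t → (f ⊛ g) (suc t) ≡ f 0 * g (suc t) + (tail f ⊛ g) t
  ⊛-suc f g t = cong (λ s → f 0 * g (suc t) + sumℤ s)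
    (trans (map-applyUpTo suc (λ i → f i * g (suc t ∸ i)) (suc t))
           (sym (map-upTo (λ i → f (suc i) * g (t ∸ i)) (suc t))))

  ⊛-congˡ : ∀ {f f′} g → f ≈S f′ → (f ⊛ g) ≈S (f′ ⊛ g)
  ⊛-congˡ {f} {f′} g f≈f′ zero = begin
    (f ⊛ g) 0    ≡⟨ ⊛-zero f g ⟩
    f 0 * g 0    ≡⟨ cong (_* g 0) (f≈f′ 0) ⟩
    f′ 0 * g 0   ≡⟨ ⊛-zero f′ g ⟨
    (f′ ⊛ g) 0   ∎
    where open ≡-Reasoning
  ⊛-congˡ {f} {f′} g f≈f′ (suc t) = begin
    (f ⊛ g) (suc t)                         ≡⟨ ⊛-suc f g t ⟩
    f 0 * g (suc t) + (tail f ⊛ g) t        ≡⟨ cong₂ (λ a b → a * g (suc t) + b) (f≈f′ 0)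
                                                 (⊛-congˡ g (f≈f′ ∘ suc) t) ⟩
    f′ 0 * g (suc t) + (tail f′ ⊛ g) t      ≡⟨ ⊛-suc f′ g t ⟨
    (f′ ⊛ g) (suc t)                        ∎
    where open ≡-Reasoning

  ⊛-comm : ∀ f g → (f ⊛ g) ≈S (g ⊛ f)
  ⊛-comm f g zero = trans (⊛-zero f g) (trans (ℤ.*-comm (f 0) (g 0)) (sym (⊛-zero g f)))
  ⊛-comm f g (suc zero) = begin
    (f ⊛ g) 1                      ≡⟨ ⊛-suc f g 0 ⟩
    f 0 * g 1 + (tail f ⊛ g) 0     ≡⟨ cong (_+_ (f 0 * g 1)) (⊛-zero (tail f) g) ⟩
    f 0 * g 1 + f 1 * g 0          ≡⟨ swap (f 0) (g 1) (f 1) (g 0) ⟩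
    g 0 * f 1 + g 1 * f 0          ≡⟨ cong (_+_ (g 0 * f 1)) (⊛-zero (tail g) f) ⟨
    g 0 * f 1 + (tail g ⊛ f) 0     ≡⟨ ⊛-suc g f 0 ⟨
    (g ⊛ f) 1                      ∎
    where
    open ≡-Reasoning
    swap : ∀ a b c d → a * b + c * d ≡ d * c + b * a
    swap = solve-∀
  ⊛-comm f g (suc (suc t)) = begin
    (f ⊛ g) (2+ t)                                  ≡⟨ ⊛-suc f g (suc t) ⟩
    f 0 * g (2+ t) + (tail f ⊛ g) (suc t)           ≡⟨ cong (_+_ a) (⊛-comm (tail f) g (suc t)) ⟩
    a + (g ⊛ tail f) (suc t)                        ≡⟨ cong (_+_ a) (⊛-suc g (tail f) t) ⟩
    a + (g 0 * f (2+ t) + (tail g ⊛ tail f) t)      ≡⟨ cong (λ x → a + (b + x)) (⊛-comm (tail g) (tail f) t) ⟩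
    a + (b + (tail f ⊛ tail g) t)                   ≡⟨ exchange a b _ ⟩
    b + (f 0 * g (2+ t) + (tail f ⊛ tail g) t)      ≡⟨ cong (_+_ b) (⊛-suc f (tail g) t) ⟨
    b + (f ⊛ tail g) (suc t)                        ≡⟨ cong (_+_ b) (⊛-comm f (tail g) (suc t)) ⟩
    g 0 * f (2+ t) + (tail g ⊛ f) (suc t)           ≡⟨ ⊛-suc g f (suc t) ⟨
    (g ⊛ f) (2+ t)                                  ∎
    where
    open ≡-Reasoning
    2+ : ℕ → ℕ
    2+ t = suc (suc t)
    a b : ℤ
    a = f 0 * g (2+ t)
    b = g 0 * f (2+ t)
    exchange : ∀ a b x → a + (b + x) ≡ b + (a + x)
    exchange = solve-∀

  ⊛-congʳ : ∀ f {g g′} → g ≈S g′ → (f ⊛ g) ≈S (f ⊛ g′)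
  ⊛-congʳ f {g} {g′} g≈g′ t =
    trans (⊛-comm f g t) (trans (⊛-congˡ f g≈g′ t) (⊛-comm g′ f t))

  ⊛-cong : ∀ {f f′ g g′} → f ≈S f′ → g ≈S g′ → (f ⊛ g) ≈S (f′ ⊛ g′)
  ⊛-cong {f′ = f′} {g = g} f≈f′ g≈g′ = ≈-trans (⊛-congˡ g f≈f′) (⊛-congʳ f′ g≈g′)

  ⊕-cong : ∀ {f f′ g g′} → f ≈S f′ → g ≈S g′ → (f ⊕ g) ≈S (f′ ⊕ g′)
  ⊕-cong f≈f′ g≈g′ t = cong₂ _+_ (f≈f′ t) (g≈g′ t)

  ⊕-congˡ : ∀ f {g g′} → g ≈S g′ → (f ⊕ g) ≈S (f ⊕ g′)
  ⊕-congˡ f g≈g′ t = cong (_+_ (f t)) (g≈g′ t)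

  ⊛-distribʳ : ∀ f g h → ((f ⊕ g) ⊛ h) ≈S ((f ⊛ h) ⊕ (g ⊛ h))
  ⊛-distribʳ f g h zero = begin
    ((f ⊕ g) ⊛ h) 0          ≡⟨ ⊛-zero (f ⊕ g) h ⟩
    (f 0 + g 0) * h 0        ≡⟨ ℤ.*-distribʳ-+ (h 0) (f 0) (g 0) ⟩
    f 0 * h 0 + g 0 * h 0    ≡⟨ cong₂ _+_ (⊛-zero f h) (⊛-zero g h) ⟨
    (f ⊛ h) 0 + (g ⊛ h) 0    ∎
    where open ≡-Reasoning
  ⊛-distribʳ f g h (suc t) = begin
    ((f ⊕ g) ⊛ h) (suc t)                                       ≡⟨ ⊛-suc (f ⊕ g) h t ⟩
    (f 0 + g 0) * h (suc t) + ((tail f ⊕ tail g) ⊛ h) t         ≡⟨ cong (_+_ ((f 0 + g 0) * h (suc t)))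
                                                                     (⊛-distribʳ (tail f) (tail g) h t) ⟩
    (f 0 + g 0) * h (suc t) + ((tail f ⊛ h) t + (tail g ⊛ h) t) ≡⟨ regroup (f 0) (g 0) (h (suc t)) _ _ ⟩
    (f 0 * h (suc t) + (tail f ⊛ h) t)
      + (g 0 * h (suc t) + (tail g ⊛ h) t)                      ≡⟨ cong₂ _+_ (⊛-suc f h t) (⊛-suc g h t) ⟨
    (f ⊛ h) (suc t) + (g ⊛ h) (suc t)                           ∎
    where
    open ≡-Reasoning
    regroup : ∀ a b c x y → (a + b) * c + (x + y) ≡ (a * c + x) + (b * c + y)
    regroup = solve-∀

  ⊛-distribˡ : ∀ f g h → (f ⊛ (g ⊕ h)) ≈S ((f ⊛ g) ⊕ (f ⊛ h))
  ⊛-distribˡ f g h t = trans (⊛-comm f (g ⊕ h) t)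
    (trans (⊛-distribʳ g h f t) (cong₂ _+_ (⊛-comm g f t) (⊛-comm h f t)))

  ⊛-scaleˡ : ∀ c f g → (scale c f ⊛ g) ≈S scale c (f ⊛ g)
  ⊛-scaleˡ c f g zero = begin
    (scale c f ⊛ g) 0    ≡⟨ ⊛-zero (scale c f) g ⟩
    c * f 0 * g 0        ≡⟨ ℤ.*-assoc c (f 0) (g 0) ⟩
    c * (f 0 * g 0)      ≡⟨ cong (c *_) (⊛-zero f g) ⟨
    c * (f ⊛ g) 0        ∎
    where open ≡-Reasoning
  ⊛-scaleˡ c f g (suc t) = begin
    (scale c f ⊛ g) (suc t)                            ≡⟨ ⊛-suc (scale c f) g t ⟩
    c * f 0 * g (suc t) + (scale c (tail f) ⊛ g) t     ≡⟨ cong (_+_ (c * f 0 * g (suc t)))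
                                                            (⊛-scaleˡ c (tail f) g t) ⟩
    c * f 0 * g (suc t) + c * (tail f ⊛ g) t           ≡⟨ factor c (f 0) (g (suc t)) _ ⟩
    c * (f 0 * g (suc t) + (tail f ⊛ g) t)             ≡⟨ cong (c *_) (⊛-suc f g t) ⟨
    c * (f ⊛ g) (suc t)                                ∎
    where
    open ≡-Reasoning
    factor : ∀ a b d x → a * b * d + a * x ≡ a * (b * d + x)
    factor = solve-∀

  ⊛-scaleʳ : ∀ c f g → (f ⊛ scale c g) ≈S scale c (f ⊛ g)
  ⊛-scaleʳ c f g t =
    trans (⊛-comm f (scale c g) t) (trans (⊛-scaleˡ c g f t) (cong (c *_) (⊛-comm g f t)))

  ⊛-assoc : ∀ f g h → ((f ⊛ g) ⊛ h) ≈S (f ⊛ (g ⊛ h))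
  ⊛-assoc f g h zero = begin
    ((f ⊛ g) ⊛ h) 0       ≡⟨ ⊛-zero (f ⊛ g) h ⟩
    (f ⊛ g) 0 * h 0       ≡⟨ cong (_* h 0) (⊛-zero f g) ⟩
    f 0 * g 0 * h 0       ≡⟨ ℤ.*-assoc (f 0) (g 0) (h 0) ⟩
    f 0 * (g 0 * h 0)     ≡⟨ cong (f 0 *_) (⊛-zero g h) ⟨
    f 0 * (g ⊛ h) 0       ≡⟨ ⊛-zero f (g ⊛ h) ⟨
    (f ⊛ (g ⊛ h)) 0       ∎
    where open ≡-Reasoning
  ⊛-assoc f g h (suc t) = begin
    ((f ⊛ g) ⊛ h) (suc t)
      ≡⟨ ⊛-suc (f ⊛ g) h t ⟩
    (f ⊛ g) 0 * h (suc t) + (tail (f ⊛ g) ⊛ h) t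
      ≡⟨ cong₂ _+_ (cong (_* h (suc t)) (⊛-zero f g)) (⊛-congˡ h (⊛-suc f g) t) ⟩
    f 0 * g 0 * h (suc t) + ((scale (f 0) (tail g) ⊕ (tail f ⊛ g)) ⊛ h) t
      ≡⟨ cong (_+_ (f 0 * g 0 * h (suc t))) (⊛-distribʳ (scale (f 0) (tail g)) (tail f ⊛ g) h t) ⟩
    f 0 * g 0 * h (suc t) + ((scale (f 0) (tail g) ⊛ h) t + ((tail f ⊛ g) ⊛ h) t)
      ≡⟨ cong₂ (λ x y → f 0 * g 0 * h (suc t) + (x + y))
           (⊛-scaleˡ (f 0) (tail g) h t) (⊛-assoc (tail f) g h t) ⟩
    f 0 * g 0 * h (suc t) + (f 0 * (tail g ⊛ h) t + (tail f ⊛ (g ⊛ h)) t)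
      ≡⟨ factor (f 0) (g 0) (h (suc t)) _ _ ⟩
    f 0 * (g 0 * h (suc t) + (tail g ⊛ h) t) + (tail f ⊛ (g ⊛ h)) t
      ≡⟨ cong (λ x → f 0 * x + (tail f ⊛ (g ⊛ h)) t) (⊛-suc g h t) ⟨
    f 0 * (g ⊛ h) (suc t) + (tail f ⊛ (g ⊛ h)) t
      ≡⟨ ⊛-suc f (g ⊛ h) t ⟨
    (f ⊛ (g ⊛ h)) (suc t)
      ∎
    where
    open ≡-Reasoning
    factor : ∀ a b c x y → a * b * c + (a * x + y) ≡ a * (b * c + x) + y
    factor = solve-∀

  zeroS-⊛ : ∀ g → (zeroS ⊛ g) ≈S zeroS
  zeroS-⊛ g zero    = ⊛-zero zeroS g
  zeroS-⊛ g (suc t) = trans (⊛-suc zeroS g t) (trans (ℤ.+-identityˡ _) (zeroS-⊛ g t))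

  qpow-suc-⊛ : ∀ e f t → (qpow (suc e) ⊛ f) (suc t) ≡ (qpow e ⊛ f) t
  qpow-suc-⊛ e f t = trans (⊛-suc (qpow (suc e)) f t) (ℤ.+-identityˡ _)

  ⊛-identityˡ : ∀ f → (qpow 0 ⊛ f) ≈S f
  ⊛-identityˡ f zero    = trans (⊛-zero (qpow 0) f) (ℤ.*-identityˡ (f 0))
  ⊛-identityˡ f (suc t) = begin
    (qpow 0 ⊛ f) (suc t)                    ≡⟨ ⊛-suc (qpow 0) f t ⟩
    + 1 * f (suc t) + (zeroS ⊛ f) t         ≡⟨ cong₂ _+_ (ℤ.*-identityˡ (f (suc t))) (zeroS-⊛ f t) ⟩
    f (suc t) + + 0                         ≡⟨ ℤ.+-identityʳ (f (suc t)) ⟩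
    f (suc t)                               ∎
    where open ≡-Reasoning

  ⊛-identityʳ : ∀ f → (f ⊛ qpow 0) ≈S f
  ⊛-identityʳ f = ≈-trans (⊛-comm f (qpow 0)) (⊛-identityˡ f)

  ⊛-commutativeMonoid : CommutativeMonoid _ _
  ⊛-commutativeMonoid = record
    { Carrier = Series
    ; _≈_     = _≈S_
    ; _∙_     = _⊛_
    ; ε       = qpow 0
    ; isCommutativeMonoid = record
      { isMonoid = record
        { isSemigroup = record
          { isMagma = record
            { isEquivalence = Setoid.isEquivalence ≈-setoid
            ; ∙-cong        = ⊛-cong
            }
          ; assoc = ⊛-assoc
          }
        ; identity = ⊛-identityˡ , ⊛-identityʳ
        }
      ; comm = ⊛-comm
      }
    }

  qpow-+ : ∀ a b → (qpow a ⊛ qpow b) ≈S qpow (a ℕ+ b)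
  qpow-+ zero    b         = ⊛-identityˡ (qpow b)
  qpow-+ (suc a) b zero    = ⊛-zero (qpow (suc a)) (qpow b)
  qpow-+ (suc a) b (suc t) = trans (qpow-suc-⊛ a (qpow b) t) (qpow-+ a b t)

  oneMinusQ-≈ : ∀ i → oneMinusQ (suc i) ≈S (qpow 0 ⊕ scale (- + 1) (qpow (suc i)))
  oneMinusQ-≈ i zero = refl
  oneMinusQ-≈ i (suc t) with t ≡ᵇ i
  ... | true  = refl
  ... | false = refl

  qpow-⊛-oneMinusQ : ∀ x y →
    (qpow x ⊛ oneMinusQ (suc y)) ≈S (qpow x ⊕ scale (- + 1) (qpow (x ℕ+ suc y)))
  qpow-⊛-oneMinusQ x y = begin
    qpow x ⊛ oneMinusQ (suc y)
      ≈⟨ ⊛-congʳ (qpow x) (oneMinusQ-≈ y) ⟩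
    qpow x ⊛ (qpow 0 ⊕ scale (- + 1) (qpow (suc y)))
      ≈⟨ ⊛-distribˡ (qpow x) (qpow 0) (scale (- + 1) (qpow (suc y))) ⟩
    (qpow x ⊛ qpow 0) ⊕ (qpow x ⊛ scale (- + 1) (qpow (suc y)))
      ≈⟨ ⊕-cong (⊛-identityʳ (qpow x)) (≈-trans (⊛-scaleʳ (- + 1) (qpow x) (qpow (suc y)))
                                                (λ t → cong (- + 1 *_) (qpow-+ x (suc y) t))) ⟩
    qpow x ⊕ scale (- + 1) (qpow (x ℕ+ suc y))
      ∎
    where open ≈-Reasoning

module Booleans where

  open import Defs using (allᵇ)
  open import Data.Bool using (Bool; true; false; _∧_)
  open import Data.Bool.Properties as Bool using (T-≡; ¬-not)
  open import Data.List using (applyUpTo)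
  open import Data.Nat using (ℕ; zero; suc; _≤_; _<_; _≤ᵇ_; _≡ᵇ_; z≤n; s≤s)
  import Data.Nat.Properties as ℕ
  open import Data.Product using (_×_; _,_)
  open import Function using (Equivalence; _∘_)
  open import Relation.Binary.PropositionalEquality
  open Equivalence using (to; from)

  ∧-true⁻ : ∀ {a b} → a ∧ b ≡ true → a ≡ true × b ≡ true
  ∧-true⁻ {true} {true} _ = refl , refl

  ≤ᵇ-true : ∀ {m n} → m ≤ n → (m ≤ᵇ n) ≡ true
  ≤ᵇ-true m≤n = to T-≡ (ℕ.≤⇒≤ᵇ m≤n)

  ≤ᵇ-sound : ∀ {m n} → (m ≤ᵇ n) ≡ true → m ≤ n
  ≤ᵇ-sound {m} {n} e = ℕ.≤ᵇ⇒≤ m n (from T-≡ e)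

  ≤ᵇ-false : ∀ {m n} → n < m → (m ≤ᵇ n) ≡ false
  ≤ᵇ-false n<m = ¬-not (λ m≤ᵇn → ℕ.<⇒≱ n<m (≤ᵇ-sound m≤ᵇn))

  ≡ᵇ-true : ∀ {m n} → m ≡ n → (m ≡ᵇ n) ≡ true
  ≡ᵇ-true {m} {n} m≡n = to T-≡ (ℕ.≡⇒≡ᵇ m n m≡n)

  ≡ᵇ-false : ∀ {m n} → m ≢ n → (m ≡ᵇ n) ≡ false
  ≡ᵇ-false {m} {n} m≢n = ¬-not (λ m≡ᵇn → m≢n (ℕ.≡ᵇ⇒≡ m n (from T-≡ m≡ᵇn)))

  ≤ᵇ-suc : ∀ m n → (suc m ≤ᵇ suc n) ≡ (m ≤ᵇ n)
  ≤ᵇ-suc zero    n = refl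
  ≤ᵇ-suc (suc m) n = refl

  allᵇ-true : ∀ (p : ℕ → Bool) f n → (∀ j → j < n → p (f j) ≡ true) →
    allᵇ p (applyUpTo f n) ≡ true
  allᵇ-true p f zero    _   = refl
  allᵇ-true p f (suc n) all =
    cong₂ _∧_ (all 0 (s≤s z≤n)) (allᵇ-true p (f ∘ suc) n (λ j j<n → all (suc j) (s≤s j<n)))

  allᵇ-false : ∀ (p : ℕ → Bool) f {n} j → j < n → p (f j) ≡ false → allᵇ p (applyUpTo f n) ≡ false
  allᵇ-false p f {suc n} zero (s≤s _) pj≡false = cong (_∧ allᵇ p (applyUpTo (f ∘ suc) n)) pj≡false
  allᵇ-false p f {suc n} (suc j) (s≤s j<n) pj≡false =
    trans (cong (p (f 0) ∧_) (allᵇ-false p (f ∘ suc) j j<n pj≡false)) (Bool.∧-zeroʳ _)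

module Partitions where

  open import Defs using (Series; _⊛_; qpow; oneMinusQ; poch; _≈S_)
  open SeriesAlgebra
  import Algebra.Solver.CommutativeMonoid as CommutativeMonoidSolver
  open import Data.Bool using (if_then_else_)
  open import Data.Integer using (+_; -_; _+_; _*_)
  open import Data.Integer.Tactic.RingSolver using (solve-∀)
  open import Data.Nat using (ℕ; zero; suc; _≡ᵇ_) renaming (_+_ to _ℕ+_)
  import Data.Nat.Properties as ℕ
  import Data.Nat.Tactic.RingSolver as ℕ-Solver
  open import Relation.Binary.PropositionalEquality

  open CommutativeMonoidSolver ⊛-commutativeMonoid using (solve; _⊜_) renaming (_⊕_ to _·_)

  shift : ℕ → (ℕ → ℕ) → ℕ → ℕ
  shift zero    h         = h
  shift (suc e) h zero    = 0
  shift (suc e) h (suc t) = shift e h t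

  ⟦_⟧ : (ℕ → ℕ) → Series
  ⟦ h ⟧ t = + h t

  ⟦shift⟧ : ∀ e h → ⟦ shift e h ⟧ ≈S (qpow e ⊛ ⟦ h ⟧)
  ⟦shift⟧ zero    h         = ≈-sym (⊛-identityˡ ⟦ h ⟧)
  ⟦shift⟧ (suc e) h zero    = sym (⊛-zero (qpow (suc e)) ⟦ h ⟧)
  ⟦shift⟧ (suc e) h (suc t) = trans (⟦shift⟧ e h t) (sym (qpow-suc-⊛ e ⟦ h ⟧ t))

  -- partitions N b t: the number of partitions of t into exactly b parts, each at most N
  partitions : ℕ → ℕ → ℕ → ℕ
  partitions N       zero    t = if t ≡ᵇ 0 then 1 else 0
  partitions zero    (suc b) t = 0
  partitions (suc N) (suc b) t = partitions N (suc b) t ℕ+ shift (suc N) (partitions (suc N) b) t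

  partitions-zero : ∀ N → ⟦ partitions N 0 ⟧ ≈S qpow 0
  partitions-zero N zero    = refl
  partitions-zero N (suc t) = refl

  partitions-one : ∀ b → ⟦ partitions 1 b ⟧ ≈S qpow b
  partitions-one zero    = partitions-zero 1
  partitions-one (suc b) = begin
    ⟦ shift 1 (partitions 1 b) ⟧    ≈⟨ ⟦shift⟧ 1 (partitions 1 b) ⟩
    qpow 1 ⊛ ⟦ partitions 1 b ⟧     ≈⟨ ⊛-congʳ (qpow 1) (partitions-one b) ⟩
    qpow 1 ⊛ qpow b                 ≈⟨ qpow-+ 1 b ⟩
    qpow (suc b)                    ∎
    where open ≈-Reasoning

  partitions-pascal : ∀ N b → ⟦ partitions (suc N) (suc b) ⟧
    ≈S (⟦ partitions N (suc b) ⟧ ⊕ (qpow (suc N) ⊛ ⟦ partitions (suc N) b ⟧))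
  partitions-pascal N b t =
    cong (_+_ (+ partitions N (suc b) t)) (⟦shift⟧ (suc N) (partitions (suc N) b) t)

  -- the middle terms ∓ q^(N+b+2) cancel
  pascal-weights : ∀ N b →
    ((qpow (suc b) ⊛ oneMinusQ (suc N)) ⊕ (qpow (suc (suc N)) ⊛ (qpow b ⊛ oneMinusQ (suc b))))
      ≈S (qpow (suc b) ⊛ oneMinusQ (suc (N ℕ+ suc b)))
  pascal-weights N b = begin
    (qpow (suc b) ⊛ oneMinusQ (suc N)) ⊕ (qpow (suc (suc N)) ⊛ (qpow b ⊛ oneMinusQ (suc b)))
      ≈⟨ ⊕-cong (qpow-⊛-oneMinusQ (suc b) N) (⊛-congʳ (qpow (suc (suc N))) (qpow-⊛-oneMinusQ b b)) ⟩
    (qpow (suc b) ⊕ -q (suc b ℕ+ suc N)) ⊕ (qpow (suc (suc N)) ⊛ (qpow b ⊕ -q (b ℕ+ suc b)))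
      ≈⟨ ⊕-congˡ (qpow (suc b) ⊕ -q (suc b ℕ+ suc N))
                 (⊛-distribˡ (qpow (suc (suc N))) (qpow b) (-q (b ℕ+ suc b))) ⟩
    (qpow (suc b) ⊕ -q (suc b ℕ+ suc N))
      ⊕ ((qpow (suc (suc N)) ⊛ qpow b) ⊕ (qpow (suc (suc N)) ⊛ -q (b ℕ+ suc b)))
      ≈⟨ ⊕-congˡ (qpow (suc b) ⊕ -q (suc b ℕ+ suc N)) (⊕-cong (qpow-+ (suc (suc N)) b)
           (≈-trans (⊛-scaleʳ (- + 1) (qpow (suc (suc N))) (qpow (b ℕ+ suc b)))
                    (λ t → cong (- + 1 *_) (qpow-+ (suc (suc N)) (b ℕ+ suc b) t)))) ⟩
    (qpow (suc b) ⊕ -q (suc b ℕ+ suc N)) ⊕ (qpow (suc (suc N) ℕ+ b) ⊕ -q (suc (suc N) ℕ+ (b ℕ+ suc b)))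
      ≈⟨ telescope ⟩
    qpow (suc b) ⊕ -q (suc b ℕ+ suc (N ℕ+ suc b))
      ≈⟨ qpow-⊛-oneMinusQ (suc b) (N ℕ+ suc b) ⟨
    qpow (suc b) ⊛ oneMinusQ (suc (N ℕ+ suc b))
      ∎
    where
    open ≈-Reasoning
    -q : ℕ → Series
    -q e = scale (- + 1) (qpow e)
    middle : ∀ N b → suc b ℕ+ suc N ≡ suc (suc N) ℕ+ b
    middle = ℕ-Solver.solve-∀
    last : ∀ N b → suc (suc N) ℕ+ (b ℕ+ suc b) ≡ suc b ℕ+ suc (N ℕ+ suc b)
    last = ℕ-Solver.solve-∀
    cancel : ∀ x y z → x + - + 1 * y + (y + - + 1 * z) ≡ x + - + 1 * z
    cancel = solve-∀
    telescope :
      ((qpow (suc b) ⊕ -q (suc b ℕ+ suc N)) ⊕ (qpow (suc (suc N) ℕ+ b) ⊕ -q (suc (suc N) ℕ+ (b ℕ+ suc b))))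
        ≈S (qpow (suc b) ⊕ -q (suc b ℕ+ suc (N ℕ+ suc b)))
    telescope t rewrite middle N b | last N b = cancel (qpow (suc b) t) _ _

  partitions-gaussian : ∀ N b →
    (⟦ partitions (suc N) b ⟧ ⊛ poch N ⊛ poch b) ≈S (qpow b ⊛ poch (N ℕ+ b))
  partitions-gaussian N zero = begin
    ⟦ partitions (suc N) 0 ⟧ ⊛ poch N ⊛ qpow 0   ≈⟨ ⊛-identityʳ _ ⟩
    ⟦ partitions (suc N) 0 ⟧ ⊛ poch N            ≈⟨ ⊛-congˡ (poch N) (partitions-zero (suc N)) ⟩
    qpow 0 ⊛ poch N                              ≡⟨ cong (λ n → qpow 0 ⊛ poch n) (ℕ.+-identityʳ N) ⟨
    qpow 0 ⊛ poch (N ℕ+ 0)                       ∎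
    where open ≈-Reasoning
  partitions-gaussian zero (suc b) =
    ⊛-congˡ (poch (suc b)) (≈-trans (⊛-identityʳ _) (partitions-one (suc b)))
  partitions-gaussian (suc N) (suc b) = begin
    ⟦ partitions (suc (suc N)) (suc b) ⟧ ⊛ P₁ ⊛ P₂
      ≈⟨ ⊛-congˡ P₂ (⊛-congˡ P₁ (partitions-pascal (suc N) b)) ⟩
    (Y ⊕ (v ⊛ Z)) ⊛ P₁ ⊛ P₂
      ≈⟨ ⊛-congˡ P₂ (⊛-distribʳ Y (v ⊛ Z) P₁) ⟩
    ((Y ⊛ P₁) ⊕ (v ⊛ Z ⊛ P₁)) ⊛ P₂
      ≈⟨ ⊛-distribʳ (Y ⊛ P₁) (v ⊛ Z ⊛ P₁) P₂ ⟩
    (Y ⊛ P₁ ⊛ P₂) ⊕ (v ⊛ Z ⊛ P₁ ⊛ P₂)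
      ≈⟨ ⊕-cong first second ⟩
    (R ⊛ (u ⊛ a)) ⊕ (R ⊛ (v ⊛ (w ⊛ c)))
      ≈⟨ ⊛-distribˡ R (u ⊛ a) (v ⊛ (w ⊛ c)) ⟨
    R ⊛ ((u ⊛ a) ⊕ (v ⊛ (w ⊛ c)))
      ≈⟨ ⊛-congʳ R (pascal-weights N b) ⟩
    R ⊛ (u ⊛ d)
      ≈⟨ solve 3 (λ R u d → R · (u · d) ⊜ u · (R · d)) ≈-refl R u d ⟩
    u ⊛ (R ⊛ d)
      ∎
    where
    open ≈-Reasoning
    Y = ⟦ partitions (suc N) (suc b) ⟧
    Z = ⟦ partitions (suc (suc N)) b ⟧
    u = qpow (suc b)
    v = qpow (suc (suc N))
    w = qpow b
    a = oneMinusQ (suc N)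
    c = oneMinusQ (suc b)
    d = oneMinusQ (suc (N ℕ+ suc b))
    P₁ = poch (suc N)
    P₂ = poch (suc b)
    R = poch (N ℕ+ suc b)
    first : (Y ⊛ P₁ ⊛ P₂) ≈S (R ⊛ (u ⊛ a))
    first = begin
      Y ⊛ (poch N ⊛ a) ⊛ P₂
        ≈⟨ solve 4 (λ Y p a P → (Y · (p · a)) · P ⊜ ((Y · p) · P) · a) ≈-refl Y (poch N) a P₂ ⟩
      Y ⊛ poch N ⊛ P₂ ⊛ a
        ≈⟨ ⊛-congˡ a (partitions-gaussian N (suc b)) ⟩
      u ⊛ R ⊛ a
        ≈⟨ solve 3 (λ u R a → (u · R) · a ⊜ R · (u · a)) ≈-refl u R a ⟩
      R ⊛ (u ⊛ a)
        ∎
    second : (v ⊛ Z ⊛ P₁ ⊛ P₂) ≈S (R ⊛ (v ⊛ (w ⊛ c)))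
    second = begin
      v ⊛ Z ⊛ P₁ ⊛ (poch b ⊛ c)
        ≈⟨ solve 5 (λ v Z p q c → ((v · Z) · p) · (q · c) ⊜ v · (((Z · p) · q) · c)) ≈-refl v Z P₁ (poch b) c ⟩
      v ⊛ (Z ⊛ P₁ ⊛ poch b ⊛ c)
        ≈⟨ ⊛-congʳ v (⊛-congˡ c (partitions-gaussian (suc N) b)) ⟩
      v ⊛ (w ⊛ poch (suc N ℕ+ b) ⊛ c)
        ≡⟨ cong (λ n → v ⊛ (w ⊛ poch n ⊛ c)) (ℕ.+-suc N b) ⟨
      v ⊛ (w ⊛ R ⊛ c)
        ≈⟨ solve 4 (λ v w R c → v · ((w · R) · c) ⊜ R · (v · (w · c))) ≈-refl v w R c ⟩
      R ⊛ (v ⊛ (w ⊛ c))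
        ∎

module ShiftedPartitions where

  open Booleans using (≤ᵇ-suc; ≤ᵇ-true; ≤ᵇ-false)
  open Partitions using (shift; partitions)
  open import Data.Bool using (true; false; if_then_else_)
  open import Data.Nat using (zero; suc; _+_; _∸_; _≡ᵇ_; _≤ᵇ_; _<_)
  import Data.Nat.Properties as ℕ
  open import Relation.Binary.PropositionalEquality

  shift-+ : ∀ a b h n → shift (a + b) h n ≡ (if a ≤ᵇ n then shift b h (n ∸ a) else 0)
  shift-+ zero    b h n       = refl
  shift-+ (suc a) b h zero    = refl
  shift-+ (suc a) b h (suc n) =
    trans (shift-+ a b h n) (cong (λ c → if c then shift b h (n ∸ a) else 0) (sym (≤ᵇ-suc a n)))

  shift-+-distrib : ∀ S f g n → shift S (λ t → f t + g t) n ≡ shift S f n + shift S g n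
  shift-+-distrib zero    f g n       = refl
  shift-+-distrib (suc S) f g zero    = refl
  shift-+-distrib (suc S) f g (suc n) = shift-+-distrib S f g n

  shift-shift : ∀ a b h n → shift a (shift b h) n ≡ shift (a + b) h n
  shift-shift zero    b h n       = refl
  shift-shift (suc a) b h zero    = refl
  shift-shift (suc a) b h (suc n) = shift-shift a b h n

  shift-partitions-zero : ∀ v N n → shift v (partitions N 0) n ≡ (if v ≡ᵇ n then 1 else 0)
  shift-partitions-zero zero    N zero    = refl
  shift-partitions-zero zero    N (suc n) = refl
  shift-partitions-zero (suc v) N zero    = refl
  shift-partitions-zero (suc v) N (suc n) = shift-partitions-zero v N n

  closedForm : ℕ → ℕ → ℕ → ℕ → ℕ → ℕ
  closedForm i m N S n = if i ≤ᵇ m then shift S (partitions N (m ∸ i)) n else 0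

  closedForm-active : ∀ {i m} N S n → i ≤ m → closedForm i m N S n ≡ shift S (partitions N (m ∸ i)) n
  closedForm-active N S n i≤m rewrite ≤ᵇ-true i≤m = refl

  closedForm-inactive : ∀ {i m} N S n → m < i → closedForm i m N S n ≡ 0
  closedForm-inactive N S n m<i rewrite ≤ᵇ-false m<i = refl

  closedForm-suc : ∀ i m N S n → closedForm (suc i) (suc m) N S n ≡ closedForm i m N S n
  closedForm-suc i m N S n = cong (λ c → if c then shift S (partitions N (m ∸ i)) n else 0) (≤ᵇ-suc i m)

  closedForm-pascal : ∀ i m N S n →
    closedForm i m N S n + closedForm (suc i) m (suc N) (suc N + S) n ≡ closedForm i m (suc N) S n
  closedForm-pascal zero    zero    N S n = ℕ.+-identityʳ _
  closedForm-pascal zero    (suc m) N S n = begin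
    shift S (partitions N (suc m)) n + closedForm 1 (suc m) (suc N) (suc N + S) n
      ≡⟨ cong (shift S (partitions N (suc m)) n +_) (closedForm-suc 0 m (suc N) (suc N + S) n) ⟩
    shift S (partitions N (suc m)) n + shift (suc N + S) (partitions (suc N) m) n
      ≡⟨ cong (shift S (partitions N (suc m)) n +_)
              (trans (cong (λ e → shift e (partitions (suc N) m) n) (ℕ.+-comm (suc N) S))
                     (sym (shift-shift S (suc N) (partitions (suc N) m) n))) ⟩
    shift S (partitions N (suc m)) n + shift S (shift (suc N) (partitions (suc N) m)) n
      ≡⟨ shift-+-distrib S (partitions N (suc m)) (shift (suc N) (partitions (suc N) m)) n ⟨
    shift S (partitions (suc N) (suc m)) n
      ∎
    where open ≡-Reasoning
  closedForm-pascal (suc i) zero    N S n = refl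
  closedForm-pascal (suc i) (suc m) N S n =
    trans (cong₂ _+_ (closedForm-suc i m N S n) (closedForm-suc (suc i) m (suc N) (suc N + S) n))
          (trans (closedForm-pascal i m N S n) (sym (closedForm-suc i m (suc N) S n)))

  closedForm-pascal+ : ∀ i m b d S n → closedForm i m (b + d) S n
    + closedForm (suc i) m (b + suc d) (b + suc d + S) n ≡ closedForm i m (b + suc d) S n
  closedForm-pascal+ i m b d S n rewrite ℕ.+-suc b d = closedForm-pascal i m (b + d) S n

  closedForm-prepend : ∀ i m N S n →
    (if N ≤ᵇ n then closedForm i m N S (n ∸ N) else 0) ≡ closedForm (suc i) (suc m) N (N + S) n
  closedForm-prepend i m N S n = trans prepend (sym (closedForm-suc i m N (N + S) n))
    where
    prepend : (if N ≤ᵇ n then closedForm i m N S (n ∸ N) else 0) ≡ closedForm i m N (N + S) n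
    prepend rewrite shift-+ N S (partitions N (m ∸ i)) n with N ≤ᵇ n | i ≤ᵇ m
    ... | true  | true  = refl
    ... | true  | false = refl
    ... | false | true  = refl
    ... | false | false = refl

module Bracket where

  open import Defs using (_⊛_; qpow; zeroS; poch; _≈S_; IsQPowBracket)
  open SeriesAlgebra
  open Partitions using (⟦_⟧; ⟦shift⟧; partitions; partitions-gaussian)
  open ShiftedPartitions using (closedForm; closedForm-active; closedForm-inactive)
  open import Data.Empty using (⊥-elim)
  open import Data.Integer using (ℤ; +_; -_; _+_; _-_; ∣_∣; +≤+; +<+)
  import Data.Integer as ℤ using (_≤_; _<_)
  import Data.Integer.Properties as ℤ
  open import Data.Integer.Tactic.RingSolver using (solve-∀)
  open import Data.Nat using (suc; _∸_; z≤n) renaming (_+_ to _ℕ+_)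
  import Data.Nat.Properties as ℕ
  open import Data.Product using (_,_)
  open import Relation.Binary.PropositionalEquality
  open import Relation.Nullary using (yes; no)

  IsQPowBracket-resp : ∀ {f g e A B} → f ≈S g → IsQPowBracket g e A B → IsQPowBracket f e A B
  IsQPowBracket-resp {A = A} {B} f≈g (nonzero , vanishing) =
    (λ 0≤B B≤A → let (n , e≡n , identity) = nonzero 0≤B B≤A
                 in  n , e≡n , ≈-trans (⊛-congˡ (poch ∣ A - B ∣) (⊛-congˡ (poch ∣ B ∣) f≈g)) identity)
    , λ ¬bounds → ≈-trans f≈g (vanishing ¬bounds)

  -- for i ≤ m this is partitions-gaussian; for m < i the bracket vanishes because A < B
  closedForm-bracket : ∀ i m N S {e A B} → B ≡ + N → A ≡ (+ m - + i) + B → e ≡ (+ m - + i) + + S →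
    IsQPowBracket ⟦ closedForm i m (suc N) S ⟧ e A B
  closedForm-bracket i m N S refl refl refl with i ℕ.≤? m
  ... | yes i≤m = (λ _ _ → b ℕ+ S , cong (_+ + S) m-i≡b , series)
                , (λ ¬bounds → ⊥-elim (¬bounds (+≤+ z≤n , B≤A)))
    where
    open ≈-Reasoning
    b = m ∸ i
    m-i≡b : + m - + i ≡ + b
    m-i≡b = trans (ℤ.m-n≡m⊖n m i) (ℤ.⊖-≥ i≤m)
    B≤A : + N ℤ.≤ (+ m - + i) + + N
    B≤A = subst (λ x → + N ℤ.≤ x + + N) (sym m-i≡b) (+≤+ (ℕ.m≤n+m N b))
    A-B≡b : (+ m - + i) + + N - + N ≡ + b
    A-B≡b = trans (cancel (+ m - + i) (+ N)) m-i≡b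
      where
      cancel : ∀ x y → x + y - y ≡ x
      cancel = solve-∀
    ∣A∣≡N+b : ∣ (+ m - + i) + + N ∣ ≡ N ℕ+ b
    ∣A∣≡N+b = trans (cong (λ x → ∣ x + + N ∣) m-i≡b) (ℕ.+-comm b N)
    P = ⟦ partitions (suc N) b ⟧
    active : ⟦ closedForm i m (suc N) S ⟧ ≈S (qpow S ⊛ P)
    active n = trans (cong +_ (closedForm-active (suc N) S n i≤m)) (⟦shift⟧ S (partitions (suc N) b) n)
    series : (⟦ closedForm i m (suc N) S ⟧ ⊛ poch N ⊛ poch ∣ (+ m - + i) + + N - + N ∣)
               ≈S (qpow (b ℕ+ S) ⊛ poch ∣ (+ m - + i) + + N ∣)
    series = begin
      ⟦ closedForm i m (suc N) S ⟧ ⊛ poch N ⊛ poch ∣ (+ m - + i) + + N - + N ∣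
        ≡⟨ cong (λ x → ⟦ closedForm i m (suc N) S ⟧ ⊛ poch N ⊛ poch ∣ x ∣) A-B≡b ⟩
      ⟦ closedForm i m (suc N) S ⟧ ⊛ poch N ⊛ poch b
        ≈⟨ ⊛-congˡ (poch b) (⊛-congˡ (poch N) active) ⟩
      qpow S ⊛ P ⊛ poch N ⊛ poch b
        ≈⟨ ≈-trans (⊛-congˡ (poch b) (⊛-assoc (qpow S) P (poch N)))
                   (⊛-assoc (qpow S) (P ⊛ poch N) (poch b)) ⟩
      qpow S ⊛ (P ⊛ poch N ⊛ poch b)
        ≈⟨ ⊛-congʳ (qpow S) (partitions-gaussian N b) ⟩
      qpow S ⊛ (qpow b ⊛ poch (N ℕ+ b))
        ≈⟨ ⊛-assoc (qpow S) (qpow b) (poch (N ℕ+ b)) ⟨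
      qpow S ⊛ qpow b ⊛ poch (N ℕ+ b)
        ≈⟨ ⊛-congˡ (poch (N ℕ+ b)) (qpow-+ S b) ⟩
      qpow (S ℕ+ b) ⊛ poch (N ℕ+ b)
        ≡⟨ cong₂ (λ e n → qpow e ⊛ poch n) (ℕ.+-comm S b) (sym ∣A∣≡N+b) ⟩
      qpow (b ℕ+ S) ⊛ poch ∣ (+ m - + i) + + N ∣
        ∎
  ... | no i≰m = (λ _ B≤A → ⊥-elim (ℤ.<⇒≱ A<B B≤A)) , (λ _ → vanishes)
    where
    m-i<0 : + m - + i ℤ.< + 0
    m-i<0 = subst (+ m - + i ℤ.<_) (ℤ.+-inverseʳ (+ i)) (ℤ.+-monoˡ-< (- + i) (+<+ (ℕ.≰⇒> i≰m)))
    A<B : (+ m - + i) + + N ℤ.< + N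
    A<B = ℤ.+-monoˡ-< (+ N) m-i<0
    vanishes : ⟦ closedForm i m (suc N) S ⟧ ≈S zeroS
    vanishes n = cong +_ (closedForm-inactive (suc N) S n (ℕ.≰⇒> i≰m))

module Counting where

  open import Defs using (lists)
  open import Data.Bool using (Bool; true; false; if_then_else_)
  open import Data.Bool.Properties using (T?)
  open import Data.List using (List; []; _∷_; _++_; map; concatMap; filter; length; applyUpTo)
  open import Data.List.Relation.Unary.All as All using (All; _∷_)
  open import Data.Empty using (⊥-elim)
  open import Data.Nat using (ℕ; zero; suc; _+_; _∸_; _≤_; _<_; z≤n; s≤s)
  import Data.Nat.Properties as ℕ
  open import Function using (_∘_)
  open import Relation.Binary.PropositionalEquality

  count : {A : Set} → (A → Bool) → List A → ℕ
  count p []       = 0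
  count p (x ∷ xs) = (if p x then 1 else 0) + count p xs

  length-filter : {A : Set} (p : A → Bool) (xs : List A) →
    length (filter (λ x → T? (p x)) xs) ≡ count p xs
  length-filter p []       = refl
  length-filter p (x ∷ xs) with p x
  ... | true  = cong suc (length-filter p xs)
  ... | false = length-filter p xs

  count-++ : {A : Set} (p : A → Bool) (xs ys : List A) → count p (xs ++ ys) ≡ count p xs + count p ys
  count-++ p []       ys = refl
  count-++ p (x ∷ xs) ys =
    trans (cong ((if p x then 1 else 0) +_) (count-++ p xs ys)) (sym (ℕ.+-assoc (if p x then 1 else 0) _ _))

  count-map : {A B : Set} (p : B → Bool) (f : A → B) (xs : List A) → count p (map f xs) ≡ count (p ∘ f) xs
  count-map p f []       = refl
  count-map p f (x ∷ xs) = cong ((if p (f x) then 1 else 0) +_) (count-map p f xs)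

  count-cong : {A : Set} {p q : A → Bool} (xs : List A) → (∀ x → p x ≡ q x) → count p xs ≡ count q xs
  count-cong []       p≗q = refl
  count-cong (x ∷ xs) p≗q = cong₂ _+_ (cong (λ b → if b then 1 else 0) (p≗q x)) (count-cong xs p≗q)

  count-none : {A : Set} {p : A → Bool} (xs : List A) → (∀ x → p x ≡ false) → count p xs ≡ 0
  count-none []       p≗false = refl
  count-none (x ∷ xs) p≗false rewrite p≗false x = count-none xs p≗false

  ∑< : ℕ → (ℕ → ℕ) → ℕ
  ∑< zero    h = 0
  ∑< (suc n) h = h 0 + ∑< n (h ∘ suc)

  ∑<-cong : ∀ n {h h′} → (∀ c → c < n → h c ≡ h′ c) → ∑< n h ≡ ∑< n h′
  ∑<-cong zero    h≗h′ = refl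
  ∑<-cong (suc n) h≗h′ =
    cong₂ _+_ (h≗h′ 0 (s≤s z≤n)) (∑<-cong n (λ c c<n → h≗h′ (suc c) (s≤s c<n)))

  ∑<-zero : ∀ n {h} → (∀ c → c < n → h c ≡ 0) → ∑< n h ≡ 0
  ∑<-zero zero    h≗0 = refl
  ∑<-zero (suc n) h≗0 =
    cong₂ _+_ (h≗0 0 (s≤s z≤n)) (∑<-zero n (λ c c<n → h≗0 (suc c) (s≤s c<n)))

  ∑<-+ : ∀ a b h → ∑< (a + b) h ≡ ∑< a h + ∑< b (λ c → h (a + c))
  ∑<-+ zero    b h = refl
  ∑<-+ (suc a) b h = trans (cong (h 0 +_) (∑<-+ a b (h ∘ suc))) (sym (ℕ.+-assoc (h 0) _ _))

  ∑<-last : ∀ L h → (∀ c → c < L → h c ≡ 0) → ∑< (suc L) h ≡ h L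
  ∑<-last zero    h _      = ℕ.+-identityʳ (h 0)
  ∑<-last (suc L) h h<L≗0 = trans (cong (_+ ∑< (suc L) (h ∘ suc)) (h<L≗0 0 (s≤s z≤n)))
    (∑<-last L (h ∘ suc) (λ c c<L → h<L≗0 (suc c) (s≤s c<L)))

  count-concatMap : {A B : Set} (p : B → Bool) (f : A → List B) (g : ℕ → A) (n : ℕ) →
    count p (concatMap f (applyUpTo g n)) ≡ ∑< n (λ c → count p (f (g c)))
  count-concatMap p f g zero    = refl
  count-concatMap p f g (suc n) =
    trans (count-++ p (f (g 0)) _) (cong (count p (f (g 0)) +_) (count-concatMap p f (g ∘ suc) n))

  count-lists : (p : List ℕ → Bool) (m L : ℕ) →
    count p (lists (suc m) L) ≡ ∑< (suc L) (λ c → count (λ ys → p (c ∷ ys)) (lists m L))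
  count-lists p m L = trans (count-concatMap p (λ c → map (c ∷_) (lists m L)) (λ c → c) (suc L))
    (∑<-cong (suc L) (λ c _ → count-map p (c ∷_) (lists m L)))

  count-lists-bounded : (m : ℕ) {y L : ℕ} (p : List ℕ → Bool) → y ≤ L →
    (∀ zs → p zs ≡ true → All (_≤ y) zs) → count p (lists m L) ≡ count p (lists m y)
  count-lists-bounded zero    p y≤L p⇒≤y = refl
  count-lists-bounded (suc m) {y} {L} p y≤L p⇒≤y = begin
    count p (lists (suc m) L)                      ≡⟨ count-lists p m L ⟩
    ∑< (suc L) H                                   ≡⟨ cong (λ n → ∑< n H) (ℕ.m+[n∸m]≡n (s≤s y≤L)) ⟨
    ∑< (suc y + (L ∸ y)) H                         ≡⟨ ∑<-+ (suc y) (L ∸ y) H ⟩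
    ∑< (suc y) H + ∑< (L ∸ y) (λ c → H (suc y + c))
      ≡⟨ cong₂ _+_ (∑<-cong (suc y) below) (∑<-zero (L ∸ y) above) ⟩
    ∑< (suc y) H′ + 0                              ≡⟨ ℕ.+-identityʳ _ ⟩
    ∑< (suc y) H′                                  ≡⟨ count-lists p m y ⟨
    count p (lists (suc m) y)                      ∎
    where
    open ≡-Reasoning
    H H′ : ℕ → ℕ
    H  c = count (λ ys → p (c ∷ ys)) (lists m L)
    H′ c = count (λ ys → p (c ∷ ys)) (lists m y)
    below : ∀ c → c < suc y → H c ≡ H′ c
    below c _ = count-lists-bounded m (λ ys → p (c ∷ ys)) y≤L (λ zs e → All.tail (p⇒≤y (c ∷ zs) e))
    above : ∀ c → c < L ∸ y → H (suc y + c) ≡ 0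
    above c _ = count-none (lists m L) too-big
      where
      too-big : ∀ zs → p (suc y + c ∷ zs) ≡ false
      too-big zs with p (suc y + c ∷ zs) in e
      ... | false = refl
      ... | true with p⇒≤y _ e
      ...   | big≤y ∷ _ = ⊥-elim (ℕ.<⇒≱ (s≤s (ℕ.m≤m+n y c)) big≤y)

module Recurrence (k r : ℕ) where

  open import Defs using (gCount; inB; partOK; pairOK; pairs; allᵇ; lastOf; size; value; over; lists; headIs)
  open Booleans
  open Counting
  import Algebra.Solver.CommutativeMonoid as CommutativeMonoidSolver
  open import Data.Bool using (Bool; true; false; if_then_else_; _∧_)
  import Data.Bool.Properties as Bool
  open import Data.List using (List; []; _∷_; length)
  open import Data.List.Relation.Unary.All as All using (All; []; _∷_)
  open import Data.Nat using (ℕ; zero; suc; _+_; _∸_; _≡ᵇ_; _≤ᵇ_; _≤_; _<_; s≤s)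
  import Data.Nat.Properties as ℕ
  open import Data.Product using (_,_; proj₁; proj₂)
  open import Relation.Binary.PropositionalEquality

  open CommutativeMonoidSolver Bool.∧-commutativeMonoid using (solve; _⊜_; _⊕_)

  headCount : ℕ → ℕ → ℕ → ℕ
  headCount m L n = count (λ ys → inB k r (suc m) (L ∷ ys) ∧ (size (L ∷ ys) ≡ᵇ n)) (lists m L)

  gCount-head : ∀ m L n → gCount k r (suc m) L n ≡ headCount m L n
  gCount-head m L n = begin
    gCount k r (suc m) L n                              ≡⟨ length-filter P (lists (suc m) L) ⟩
    count P (lists (suc m) L)                           ≡⟨ count-lists P m L ⟩
    ∑< (suc L) (λ c → count (λ ys → P (c ∷ ys)) (lists m L))
      ≡⟨ ∑<-last L _ (λ c c<L → count-none (lists m L) (λ ys → head-mismatch c ys c<L)) ⟩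
    count (λ ys → P (L ∷ ys)) (lists m L)
      ≡⟨ count-cong (lists m L) (λ ys → cong (λ b → inB k r (suc m) (L ∷ ys) ∧ (b ∧ (size (L ∷ ys) ≡ᵇ n)))
                                             (≡ᵇ-true {L} refl)) ⟩
    headCount m L n                                     ∎
    where
    open ≡-Reasoning
    P : List ℕ → Bool
    P xs = inB k r (suc m) xs ∧ headIs L xs ∧ (size xs ≡ᵇ n)
    head-mismatch : ∀ c ys → c < L → P (c ∷ ys) ≡ false
    head-mismatch c ys c<L rewrite ≡ᵇ-false (ℕ.<⇒≢ c<L) = Bool.∧-zeroʳ (inB k r (suc m) (c ∷ ys))

  pairs-descending : ∀ y zs → allᵇ (pairOK k r) (pairs (y ∷ zs)) ≡ true → All (_≤ y) zs
  pairs-descending y []       _  = []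
  pairs-descending y (z ∷ zs) ok with ∧-true⁻ {pairOK k r (y , z)} ok
  ... | yz-ok , rest-ok = z≤y ∷ All.map (λ p → ℕ.≤-trans p z≤y) (pairs-descending z zs rest-ok)
    where z≤y = ≤ᵇ-sound (proj₁ (∧-true⁻ yz-ok))

  inB-descending : ∀ m y zs → inB k r m (y ∷ zs) ≡ true → All (_≤ y) zs
  inB-descending m y zs ok =
    pairs-descending y zs (proj₂ (∧-true⁻ {last-ok} (proj₂ (∧-true⁻ {parts-ok} (proj₂ (∧-true⁻ {length-ok} ok))))))
    where
    length-ok = length (y ∷ zs) ≡ᵇ m
    parts-ok  = allᵇ (partOK k r) (y ∷ zs)
    last-ok   = lastOf (y ∷ zs) 0 ≤ᵇ over r

  inB-cons : ∀ m L y zs → inB k r (suc (suc m)) (L ∷ y ∷ zs)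
    ≡ (partOK k r L ∧ pairOK k r (L , y)) ∧ inB k r (suc m) (y ∷ zs)
  inB-cons m L y zs =
    solve 6 (λ A p B C q D → A ⊕ ((p ⊕ B) ⊕ (C ⊕ (q ⊕ D))) ⊜ (p ⊕ q) ⊕ (A ⊕ (B ⊕ (C ⊕ D)))) refl
      (length (y ∷ zs) ≡ᵇ suc m) (partOK k r L) (allᵇ (partOK k r) (y ∷ zs))
      (lastOf (y ∷ zs) 0 ≤ᵇ over r) (pairOK k r (L , y)) (allᵇ (pairOK k r) (pairs (y ∷ zs)))

  inB-cons-with : ∀ m L y zs {b} → partOK k r L ∧ pairOK k r (L , y) ≡ b →
    inB k r (suc (suc m)) (L ∷ y ∷ zs) ≡ b ∧ inB k r (suc m) (y ∷ zs)
  inB-cons-with m L y zs refl = inB-cons m L y zs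

  +≡ᵇ : ∀ a s n → ((a + s) ≡ᵇ n) ≡ (if a ≤ᵇ n then (s ≡ᵇ (n ∸ a)) else false)
  +≡ᵇ zero    s n       = refl
  +≡ᵇ (suc a) s zero    = refl
  +≡ᵇ (suc a) s (suc n) =
    trans (+≡ᵇ a s n) (cong (λ b → if b then (s ≡ᵇ (n ∸ a)) else false) (sym (≤ᵇ-suc a n)))

  -- the number of tails (y, …) ∈ B_{k,r}(m+1) of size n that may follow the largest part L
  successor : ℕ → ℕ → ℕ → ℕ → ℕ
  successor m L n y = if partOK k r L ∧ pairOK k r (L , y) then gCount k r (suc m) y n else 0

  gCount-suc : ∀ m L n → gCount k r (suc (suc m)) L n
    ≡ (if value L ≤ᵇ n then ∑< (suc L) (successor m L (n ∸ value L)) else 0)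
  gCount-suc m L n = trans (gCount-head (suc m) L n) (trans (count-lists _ m L) split-on-value)
    where
    P : ℕ → List ℕ → Bool
    P y zs = inB k r (suc (suc m)) (L ∷ y ∷ zs) ∧ (size (L ∷ y ∷ zs) ≡ᵇ n)
    size-test : ∀ {b} → (value L ≤ᵇ n) ≡ b → ∀ y zs →
      (size (L ∷ y ∷ zs) ≡ᵇ n) ≡ (if b then (size (y ∷ zs) ≡ᵇ (n ∸ value L)) else false)
    size-test refl y zs = +≡ᵇ (value L) (size (y ∷ zs)) n
    split-on-value : ∑< (suc L) (λ y → count (P y) (lists m L))
      ≡ (if value L ≤ᵇ n then ∑< (suc L) (successor m L (n ∸ value L)) else 0)
    split-on-value with value L ≤ᵇ n in L≤n
    ... | false = ∑<-zero (suc L) (λ y _ → count-none (lists m L) (λ zs →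
          trans (cong (inB k r (suc (suc m)) (L ∷ y ∷ zs) ∧_) (size-test L≤n y zs))
                (Bool.∧-zeroʳ _)))
    ... | true  = ∑<-cong (suc L) continuation
      where
      continuation : ∀ y → y < suc L → count (P y) (lists m L) ≡ successor m L (n ∸ value L) y
      continuation y (s≤s y≤L) with partOK k r L ∧ pairOK k r (L , y) in Ly-ok
      ... | false = count-none (lists m L) (λ zs →
            cong (_∧ (size (L ∷ y ∷ zs) ≡ᵇ n)) (inB-cons-with m L y zs Ly-ok))
      ... | true  = begin
        count (P y) (lists m L)  ≡⟨ count-cong (lists m L) (λ zs → cong₂ _∧_
                                      (inB-cons-with m L y zs Ly-ok)
                                      (size-test L≤n y zs)) ⟩
        count Q (lists m L)      ≡⟨ count-lists-bounded m Q y≤L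
                                      (λ zs e → inB-descending (suc m) y zs (proj₁ (∧-true⁻ {inB k r (suc m) (y ∷ zs)} e)))
                                    ⟩
        headCount m y (n ∸ value L) ≡⟨ gCount-head m y (n ∸ value L) ⟨
        gCount k r (suc m) y (n ∸ value L) ∎
        where
        open ≡-Reasoning
        Q : List ℕ → Bool
        Q zs = inB k r (suc m) (y ∷ zs) ∧ (size (y ∷ zs) ≡ᵇ (n ∸ value L))

  gCount-one-valid : ∀ L n → partOK k r L ≡ true → L ≤ over r →
    gCount k r 1 L n ≡ (if value L ≡ᵇ n then 1 else 0)
  gCount-one-valid L n L-ok L≤r̄
    rewrite gCount-head 0 L n | L-ok | ≤ᵇ-true L≤r̄ | ℕ.+-identityʳ (value L) =
    ℕ.+-identityʳ _

  gCount-one-large : ∀ L n → over r < L → gCount k r 1 L n ≡ 0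
  gCount-one-large L n r̄<L
    rewrite gCount-head 0 L n | ≤ᵇ-false r̄<L | Bool.∧-zeroʳ (partOK k r L ∧ true) = refl

  gCount-invalid-head : ∀ m L n → partOK k r L ≡ false → gCount k r (suc m) L n ≡ 0
  gCount-invalid-head m L n L-bad rewrite gCount-head m L n | L-bad =
    count-none (lists m L) (λ ys → cong (_∧ (size (L ∷ ys) ≡ᵇ n)) (Bool.∧-zeroʳ (length (L ∷ ys) ≡ᵇ suc m)))

  successor-blocked : ∀ m L n {y} → pairOK k r (L , y) ≡ false → successor m L n y ≡ 0
  successor-blocked m L n {y} Ly-bad =
    cong (λ b → if b then gCount k r (suc m) y n else 0)
         (trans (cong (partOK k r L ∧_) Ly-bad) (Bool.∧-zeroʳ _))

  successor-invalid : ∀ m L n {y} → partOK k r y ≡ false → successor m L n y ≡ 0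
  successor-invalid m L n {y} y-bad with partOK k r L ∧ pairOK k r (L , y)
  ... | true  = gCount-invalid-head m y n y-bad
  ... | false = refl

  successor-open : ∀ m L n {y} → partOK k r L ≡ true → pairOK k r (L , y) ≡ true →
    successor m L n y ≡ gCount k r (suc m) y n
  successor-open m L n L-ok Ly-ok rewrite L-ok | Ly-ok = refl

module Residues where

  open import Data.Nat using (ℕ; _+_; _∸_; _<_; _≤_; _<?_; NonZero)
  import Data.Nat.Properties as ℕ
  open import Data.Nat.DivMod using (_%_; %-distribˡ-+; m<n⇒m%n≡m; m≤n⇒[n∸m]%m≡n%m; m%n<n)
  open import Relation.Binary.PropositionalEquality
  open import Relation.Nullary using (yes; no)

  %-reduceʳ : ∀ {n} .{{_ : NonZero n}} x {d} → d < n → (x + d) % n ≡ (x % n + d) % n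
  %-reduceʳ {n} x {d} d<n = trans (%-distribˡ-+ x d n) (cong (λ e → (x % n + e) % n) (m<n⇒m%n≡m d<n))

  %-shift-≢ : ∀ {n} .{{_ : NonZero n}} x {d} → 0 < d → d < n → (x + d) % n ≢ x % n
  %-shift-≢ {n} x {d} 0<d d<n x+d≡x with x % n + d <? n
  ... | yes a+d<n = ℕ.<⇒≢ (ℕ.m<m+n (x % n) 0<d) (begin
    x % n                ≡⟨ x+d≡x ⟨
    (x + d) % n          ≡⟨ %-reduceʳ x d<n ⟩
    (x % n + d) % n      ≡⟨ m<n⇒m%n≡m a+d<n ⟩
    x % n + d            ∎)
    where open ≡-Reasoning
  ... | no a+d≮n = ℕ.<⇒≢ d<n (ℕ.+-cancelˡ-≡ (x % n) d n (begin
    x % n + d            ≡⟨ ℕ.m∸n+n≡m n≤a+d ⟨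
    (x % n + d ∸ n) + n  ≡⟨ cong (_+ n) wrapped ⟩
    x % n + n            ∎))
    where
    open ≡-Reasoning
    n≤a+d : n ≤ x % n + d
    n≤a+d = ℕ.≮⇒≥ a+d≮n
    a+d∸n<n : x % n + d ∸ n < n
    a+d∸n<n = subst (x % n + d ∸ n <_) (ℕ.m+n∸n≡m n n) (ℕ.∸-monoˡ-< (ℕ.+-mono-< (m%n<n x n) d<n) n≤a+d)
    wrapped : x % n + d ∸ n ≡ x % n
    wrapped = begin
      x % n + d ∸ n          ≡⟨ m<n⇒m%n≡m a+d∸n<n ⟨
      (x % n + d ∸ n) % n    ≡⟨ m≤n⇒[n∸m]%m≡n%m n≤a+d ⟩
      (x % n + d) % n        ≡⟨ %-reduceʳ x d<n ⟨
      (x + d) % n            ≡⟨ x+d≡x ⟩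
      x % n                  ∎

module Codes where

  open import Defs using (plain; over; value; isOver; modℕ)
  open import Data.Bool using (true; false)
  open import Data.Nat using (zero; suc; _+_; _<_; s≤s; NonZero)
  import Data.Nat.Properties as ℕ
  open import Data.Nat.DivMod using (_%_)
  open import Relation.Binary.PropositionalEquality

  value-plain : ∀ v → value (plain v) ≡ v
  value-plain zero    = refl
  value-plain (suc v) rewrite ℕ.+-suc v (v + 0) = cong suc (value-plain v)

  value-over : ∀ v → value (over v) ≡ v
  value-over zero    = refl
  value-over (suc v) rewrite ℕ.+-suc v (v + 0) = cong suc (value-over v)

  isOver-plain : ∀ v → isOver (plain v) ≡ false
  isOver-plain zero    = refl
  isOver-plain (suc v) rewrite ℕ.+-suc v (v + 0) = isOver-plain v

  isOver-over : ∀ v → isOver (over v) ≡ true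
  isOver-over zero    = refl
  isOver-over (suc v) rewrite ℕ.+-suc v (v + 0) = isOver-over v

  plain-mono : ∀ {a b} → a ≤ b → plain a ≤ plain b
  plain-mono = ℕ.*-monoʳ-≤ 2

  over-mono : ∀ {a b} → a ≤ b → over a ≤ over b
  over-mono a≤b = s≤s (plain-mono a≤b)

  over<plain : ∀ {a b} → a < b → over a < plain b
  over<plain {a} {b} a<b = subst (_≤ plain b) (ℕ.*-suc 2 a) (plain-mono a<b)

  over-< : ∀ {a b} → a < b → over a < over b
  over-< a<b = ℕ.m≤n⇒m≤1+n (over<plain a<b)

  modℕ-% : ∀ n .{{_ : NonZero n}} x → modℕ n x ≡ x % n
  modℕ-% (suc n) x = refl

module Blocks (k r : ℕ) (1≤r : 1 ≤ r) (r≤k : r ≤ k) where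

  open import Defs using (plain; over; isOver; partOK; pairOK; jCond)
  open Booleans
  open Codes
  open Residues
  open import Data.Bool using (true; false; not; _∧_; _∨_; if_then_else_)
  import Data.Bool.Properties as Bool
  open import Data.Nat using (zero; suc; _+_; _*_; _∸_; _≡ᵇ_; _≤ᵇ_; _<_; z≤n; s≤s; NonZero; >-nonZero)
  import Data.Nat.Properties as ℕ
  open import Data.Nat.DivMod using (_%_; [m+kn]%n≡m%n)
  import Data.Nat.Tactic.RingSolver as ℕ-Solver
  open import Data.Product using (_,_)
  open import Data.Sum using (_⊎_; inj₁; inj₂)
  open import Relation.Binary.PropositionalEquality
  open import Relation.Nullary using (yes; no)

  -- The codes are cut into blocks: block i runs from start i = over (base i) to plain (top i),
  -- so that (for i ≥ 1) it opens with the overlined residue k(i-1)+r̄ and ends just below k i+r̄.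
  top : ℕ → ℕ
  top i = k * i + r

  base : ℕ → ℕ
  base zero    = 0
  base (suc i) = top i

  width : ℕ → ℕ
  width zero    = r
  width (suc i) = k

  start : ℕ → ℕ
  start i = over (base i)

  staircase : ℕ → ℕ
  staircase zero    = 0
  staircase (suc i) = staircase i + top i

  1≤k : 1 ≤ k
  1≤k = ℕ.≤-trans 1≤r r≤k

  instance
    k-nonZero : NonZero k
    k-nonZero = >-nonZero 1≤k

  1≤width : ∀ i → 1 ≤ width i
  1≤width zero    = 1≤r
  1≤width (suc i) = 1≤k

  base+width : ∀ i → base i + width i ≡ top i
  base+width zero    = cong (_+ r) (sym (ℕ.*-zeroʳ k))
  base+width (suc i) = shift-block k i r
    where
    shift-block : ∀ k i r → k * i + r + k ≡ k * suc i + r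
    shift-block = ℕ-Solver.solve-∀

  start-suc : ∀ i → start (suc i) ≡ start i + 2 * width i
  start-suc i = cong suc (trans (cong (2 *_) (sym (base+width i))) (ℕ.*-distribˡ-+ 2 (base i) (width i)))

  top-mono : ∀ {i j} → i ≤ j → top i ≤ top j
  top-mono i≤j = ℕ.+-monoˡ-≤ r (ℕ.*-monoʳ-≤ k i≤j)

  top≤base : ∀ {i j} → i < j → top i ≤ base j
  top≤base {j = suc j} (s≤s i≤j) = top-mono i≤j

  i≤start : ∀ i → i ≤ start i
  i≤start zero    = z≤n
  i≤start (suc i) = s≤s (ℕ.≤-trans (ℕ.≤-trans i≤ki (ℕ.m≤m+n (k * i) r)) (ℕ.m≤n*m (top i) 2))
    where
    i≤ki : i ≤ k * i
    i≤ki = ℕ.m≤n*m i k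

  top-residue : ∀ i → top i % k ≡ r % k
  top-residue i =
    trans (cong (_% k) (trans (ℕ.+-comm (k * i) r) (cong (r +_) (ℕ.*-comm k i)))) ([m+kn]%n≡m%n r i k)

  inner-residue : ∀ i {d} → 1 ≤ d → d < width i → (base i + d) % k ≢ r % k
  inner-residue zero {d} 1≤d d<r d≡r =
    %-shift-≢ d 0<r∸d r∸d<k (trans (cong (_% k) (ℕ.m+[n∸m]≡n (ℕ.<⇒≤ d<r))) (sym d≡r))
    where
    0<r∸d : 0 < r ∸ d
    0<r∸d = ℕ.m<n⇒0<n∸m d<r
    r∸d<k : r ∸ d < k
    r∸d<k = ℕ.<-≤-trans (ℕ.∸-monoʳ-< 1≤d (ℕ.<⇒≤ d<r)) r≤k
  inner-residue (suc i) {d} 1≤d d<k ≡r =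
    %-shift-≢ r 1≤d d<k (trans (sym ([m+kn]%n≡m%n (r + d) i k)) (trans (cong (_% k) (regroup k i r d)) ≡r))
    where
    regroup : ∀ k i r d → r + d + i * k ≡ k * i + r + d
    regroup = ℕ-Solver.solve-∀

  partOK-plain : ∀ {v} → 1 ≤ v → partOK k r (plain v) ≡ true
  partOK-plain {v} 1≤v rewrite value-plain v | isOver-plain v = cong (_∧ true) (≤ᵇ-true 1≤v)

  partOK-over : ∀ v → partOK k r (over v) ≡ (1 ≤ᵇ v) ∧ (v % k ≡ᵇ r % k)
  partOK-over v rewrite value-over v | isOver-over v | modℕ-% k v | modℕ-% k r = refl

  partOK-start : ∀ i → partOK k r (start (suc i)) ≡ true
  partOK-start i = trans (partOK-over (top i))
    (cong₂ _∧_ (≤ᵇ-true (ℕ.≤-trans 1≤r (ℕ.m≤n+m r (k * i)))) (≡ᵇ-true (top-residue i)))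

  partOK-inner : ∀ i {d} → 1 ≤ d → d < width i → partOK k r (over (base i + d)) ≡ false
  partOK-inner i {d} 1≤d d<w = trans (partOK-over (base i + d))
    (trans (cong ((1 ≤ᵇ base i + d) ∧_) (≡ᵇ-false (inner-residue i 1≤d d<w))) (Bool.∧-zeroʳ _))

  lowerBound-start : ∀ i {y} → start i ≤ y → (if i ≡ᵇ 0 then true else over (k * (i ∸ 1) + r) ≤ᵇ y) ≡ true
  lowerBound-start zero    _       = refl
  lowerBound-start (suc i) start≤y = ≤ᵇ-true start≤y

  pairOK-above : ∀ i {L y} → start i ≤ y → y ≤ plain (top i) → start (suc i) < L →
    pairOK k r (L , y) ≡ false
  pairOK-above i {L} {y} start≤y y≤top above = trans
    (cong (λ b → (y ≤ᵇ L) ∧ not (isOver y ∧ (L ≡ᵇ y)) ∧ b)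
          (allᵇ-false (jCond k r L y) (λ j → j) i (s≤s (ℕ.≤-trans (i≤start i) start≤y)) violated))
    (trans (cong ((y ≤ᵇ L) ∧_) (Bool.∧-zeroʳ _)) (Bool.∧-zeroʳ _))
    where
    violated : jCond k r L y i ≡ false
    violated rewrite lowerBound-start i start≤y | ≤ᵇ-true y≤top | ≤ᵇ-false above = refl

  pairOK-repeated : ∀ L → isOver L ≡ true → pairOK k r (L , L) ≡ false
  pairOK-repeated L L-over rewrite L-over | ≡ᵇ-true {L} refl = Bool.∧-zeroʳ (L ≤ᵇ L)

  first-occurrence : ∀ {L y} → L ≢ y ⊎ isOver y ≡ false → not (isOver y ∧ (L ≡ᵇ y)) ≡ true
  first-occurrence {L} {y} (inj₁ L≢y) rewrite ≡ᵇ-false L≢y = cong not (Bool.∧-zeroʳ (isOver y))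
  first-occurrence         (inj₂ y-plain) rewrite y-plain = refl

  pairOK-within : ∀ i {L y} → start i ≤ y → y ≤ L → L ≤ start (suc i) → (L ≢ y ⊎ isOver y ≡ false) →
    pairOK k r (L , y) ≡ true
  pairOK-within i {L} {y} start≤y y≤L L≤start first =
    cong₂ _∧_ (≤ᵇ-true y≤L)
      (cong₂ _∧_ (first-occurrence first) (allᵇ-true (jCond k r L y) (λ j → j) (suc y) satisfied))
    where
    y>top : ∀ {j} → j < i → plain (top j) < y
    y>top j<i = ℕ.<-≤-trans (s≤s (plain-mono (top≤base j<i))) start≤y
    satisfied : ∀ j → j < suc y → jCond k r L y j ≡ true
    satisfied j _ with i ℕ.≤? j
    ... | yes i≤j rewrite ≤ᵇ-true (ℕ.≤-trans L≤start (over-mono (top-mono i≤j))) = Bool.∨-zeroʳ _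
    ... | no  i≰j rewrite ≤ᵇ-false (y>top (ℕ.≰⇒> i≰j)) =
      cong (λ b → not b ∨ (L ≤ᵇ over (k * j + r))) (Bool.∧-zeroʳ _)

module ClosedForm (k r : ℕ) (1≤r : 1 ≤ r) (r≤k : r ≤ k) where

  open import Defs using (gCount; plain; over; isOver; value)
  open Counting
  open Codes
  open ShiftedPartitions using (shift-partitions-zero; closedForm; closedForm-pascal+; closedForm-prepend)
  open Recurrence k r
  open Blocks k r 1≤r r≤k
  open import Data.Bool using (false; if_then_else_)
  open import Data.Nat using (zero; suc; _+_; _*_; _∸_; _≡ᵇ_; _≤ᵇ_; _<_; z≤n; s≤s)
  import Data.Nat.Properties as ℕ
  open import Data.Product using (_×_; _,_)
  import Data.Nat.Tactic.RingSolver as ℕ-Solver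
  open import Data.Sum using (_⊎_; inj₁; inj₂)
  open import Relation.Nullary using (yes; no)
  open import Relation.Binary.PropositionalEquality

  OverFormula PlainFormula : ℕ → Set
  OverFormula m = ∀ i n → gCount k r (suc m) (start i) n ≡ closedForm i (suc m) (base i) (staircase i) n
  PlainFormula m = ∀ i {d} n → 1 ≤ d → d ≤ width i →
    gCount k r (suc m) (plain (base i + d)) n ≡ closedForm (suc i) (suc m) (base i + d) (base i + d + staircase i) n

  overFormula-one : OverFormula 0
  overFormula-one zero          n = gCount-invalid-head 0 1 n refl
  overFormula-one (suc zero)    n = begin
    gCount k r 1 (start 1) n
      ≡⟨ gCount-one-valid (start 1) n (partOK-start 0) (over-mono (ℕ.≤-reflexive top0≡r)) ⟩
    (if value (over (top 0)) ≡ᵇ n then 1 else 0)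
      ≡⟨ cong (λ v → if v ≡ᵇ n then 1 else 0) (value-over (top 0)) ⟩
    (if top 0 ≡ᵇ n then 1 else 0)
      ≡⟨ shift-partitions-zero (top 0) (top 0) n ⟨
    closedForm 1 1 (top 0) (staircase 1) n
      ∎
    where
    open ≡-Reasoning
    top0≡r : top 0 ≡ r
    top0≡r = cong (_+ r) (ℕ.*-zeroʳ k)
  overFormula-one (suc (suc i)) n = gCount-one-large (start (suc (suc i))) n (over-< r<top)
    where
    r<top : r < top (suc i)
    r<top = ℕ.m<n+m r (ℕ.≤-trans 1≤k (ℕ.m≤m*n k (suc i)))

  plainFormula-one : PlainFormula 0
  plainFormula-one zero {d} n 1≤d d≤r = begin
    gCount k r 1 (plain d) n
      ≡⟨ gCount-one-valid (plain d) n (partOK-plain 1≤d) (ℕ.m≤n⇒m≤1+n (plain-mono d≤r)) ⟩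
    (if value (plain d) ≡ᵇ n then 1 else 0)
      ≡⟨ cong (λ v → if v ≡ᵇ n then 1 else 0) (trans (value-plain d) (sym (ℕ.+-identityʳ d))) ⟩
    (if d + 0 ≡ᵇ n then 1 else 0)
      ≡⟨ shift-partitions-zero (d + 0) d n ⟨
    closedForm 1 1 d (d + 0) n
      ∎
    where open ≡-Reasoning
  plainFormula-one (suc i) {d} n 1≤d _ = gCount-one-large (plain (top i + d)) n (over<plain r<top+d)
    where
    r<top+d : r < top i + d
    r<top+d = ℕ.<-≤-trans (ℕ.m<m+n r 1≤d) (ℕ.+-monoˡ-≤ d (ℕ.m≤n+m r (k * i)))

  start+even : ∀ i d → start i + (2 * d + 0) ≡ over (base i + d)
  start+even i d = even (base i) d
    where
    even : ∀ b d → suc (2 * b) + (2 * d + 0) ≡ suc (2 * (b + d))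
    even = ℕ-Solver.solve-∀

  start+odd : ∀ i d → start i + (2 * d + 1) ≡ plain (base i + suc d)
  start+odd i d = odd (base i) d
    where
    odd : ∀ b d → suc (2 * b) + (2 * d + 1) ≡ 2 * (b + suc d)
    odd = ℕ-Solver.solve-∀

  blockSum : ∀ m → OverFormula m → PlainFormula m → ∀ i {d} n → 1 ≤ d → d ≤ width i →
    ∑< (2 * d) (λ e → gCount k r (suc m) (start i + e) n) ≡ closedForm i (suc m) (base i + d) (staircase i) n
  blockSum m over-ok plain-ok i {suc zero} n _ 1≤w = begin
    G (start i + 0) + (G (start i + 1) + 0)
      ≡⟨ cong₂ _+_ (cong G (ℕ.+-identityʳ (start i)))
                   (trans (ℕ.+-identityʳ _) (cong G (start+odd i 0))) ⟩
    G (start i) + G (plain (base i + 1))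
      ≡⟨ cong₂ _+_ (trans (over-ok i n)
                          (cong (λ N → closedForm i (suc m) N S n) (sym (ℕ.+-identityʳ (base i)))))
                   (plain-ok i n (s≤s z≤n) 1≤w) ⟩
    closedForm i (suc m) (base i + 0) S n + closedForm (suc i) (suc m) (base i + 1) (base i + 1 + S) n
      ≡⟨ closedForm-pascal+ i (suc m) (base i) 0 S n ⟩
    closedForm i (suc m) (base i + 1) S n
      ∎
    where
    open ≡-Reasoning
    S = staircase i
    G : ℕ → ℕ
    G L = gCount k r (suc m) L n
  blockSum m over-ok plain-ok i {suc (suc d)} n _ D<w = begin
    ∑< (2 * suc D) h
      ≡⟨ cong (λ c → ∑< c h) (trans (ℕ.*-suc 2 D) (ℕ.+-comm 2 (2 * D))) ⟩
    ∑< (2 * D + 2) h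
      ≡⟨ ∑<-+ (2 * D) 2 h ⟩
    ∑< (2 * D) h + (h (2 * D + 0) + (h (2 * D + 1) + 0))
      ≡⟨ cong₂ _+_ (blockSum m over-ok plain-ok i {suc d} n (s≤s z≤n) (ℕ.<⇒≤ D<w))
                   (cong₂ _+_ inner-vanishes last-plain) ⟩
    closedForm i (suc m) (base i + D) S n + closedForm (suc i) (suc m) (base i + suc D) (base i + suc D + S) n
      ≡⟨ closedForm-pascal+ i (suc m) (base i) D S n ⟩
    closedForm i (suc m) (base i + suc D) S n
      ∎
    where
    open ≡-Reasoning
    D = suc d
    S = staircase i
    G h : ℕ → ℕ
    G L = gCount k r (suc m) L n
    h e = G (start i + e)
    inner-vanishes : h (2 * D + 0) ≡ 0
    inner-vanishes = trans (cong G (start+even i D)) (gCount-invalid-head m _ n (partOK-inner i (s≤s z≤n) D<w))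
    last-plain : h (2 * D + 1) + 0 ≡ closedForm (suc i) (suc m) (base i + suc D) (base i + suc D + S) n
    last-plain = trans (ℕ.+-identityʳ _) (trans (cong G (start+odd i D)) (plain-ok i n (s≤s z≤n) D<w))

  start-mono : ∀ i → start i ≤ start (suc i)
  start-mono i = ℕ.≤-trans (ℕ.m≤m+n (start i) (2 * width i)) (ℕ.≤-reflexive (sym (start-suc i)))

  lowerBlocks : ∀ m {L} n i → start i < L → ∑< (start i) (successor m L n) ≡ 0
  lowerBlocks m {L} n zero _ = trans (ℕ.+-identityʳ _) (successor-invalid m L n refl)
  lowerBlocks m {L} n (suc i) start<L = begin
    ∑< (start (suc i)) (successor m L n)
      ≡⟨ cong (λ c → ∑< c (successor m L n)) (start-suc i) ⟩
    ∑< (start i + 2 * width i) (successor m L n)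
      ≡⟨ ∑<-+ (start i) (2 * width i) (successor m L n) ⟩
    ∑< (start i) (successor m L n) + ∑< (2 * width i) (λ e → successor m L n (start i + e))
      ≡⟨ cong₂ _+_ (lowerBlocks m n i (ℕ.<-≤-trans (s≤s (start-mono i)) start<L))
                   (∑<-zero (2 * width i) blocked) ⟩
    0 ∎
    where
    open ≡-Reasoning
    blocked : ∀ e → e < 2 * width i → successor m L n (start i + e) ≡ 0
    blocked e e<2w = successor-blocked m L n (pairOK-above i (ℕ.m≤m+n (start i) e) y≤top start<L)
      where
      y≤top : start i + e ≤ plain (top i)
      y≤top = ℕ.≤-pred (ℕ.≤-trans (ℕ.+-monoʳ-< (start i) e<2w) (ℕ.≤-reflexive (sym (start-suc i))))

  gCount-via-successors : ∀ m L n {N} (F : ℕ → ℕ) → value L ≡ N →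
    (∀ n′ → ∑< (suc L) (successor m L n′) ≡ F n′) →
    gCount k r (suc (suc m)) L n ≡ (if N ≤ᵇ n then F (n ∸ N) else 0)
  gCount-via-successors m L n F refl sum≡F =
    trans (gCount-suc m L n) (cong (λ s → if value L ≤ᵇ n then s else 0) (sum≡F (n ∸ value L)))

  plainFormula-suc : ∀ m → OverFormula m → PlainFormula m → PlainFormula (suc m)
  plainFormula-suc m over-ok plain-ok i {d} n 1≤d d≤w =
    trans (gCount-via-successors m L n (closedForm i (suc m) N (staircase i)) (value-plain N) continuations)
          (closedForm-prepend i (suc m) N (staircase i) n)
    where
    N = base i + d
    L = plain N
    suc-L : suc L ≡ start i + 2 * d
    suc-L = cong suc (ℕ.*-distribˡ-+ 2 (base i) d)
    start<L : start i < L
    start<L = ℕ.≤-pred (subst (suc (suc (start i)) ≤_) (sym suc-L)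
      (ℕ.≤-trans (ℕ.≤-reflexive (ℕ.+-comm 2 (start i))) (ℕ.+-monoʳ-≤ (start i) (ℕ.*-monoʳ-≤ 2 1≤d))))
    L≤next : L ≤ start (suc i)
    L≤next = ℕ.m≤n⇒m≤1+n (plain-mono (ℕ.≤-trans (ℕ.+-monoʳ-≤ (base i) d≤w) (ℕ.≤-reflexive (base+width i))))
    continuation-open : ∀ n′ e → e < 2 * d →
      successor m L n′ (start i + e) ≡ gCount k r (suc m) (start i + e) n′
    continuation-open n′ e e<2d = successor-open m L n′ (partOK-plain (ℕ.≤-trans 1≤d (ℕ.m≤n+m d (base i))))
      (pairOK-within i (ℕ.m≤m+n (start i) e) y≤L L≤next distinct)
      where
      y = start i + e
      y≤L : y ≤ L
      y≤L = ℕ.≤-pred (ℕ.≤-trans (ℕ.+-monoʳ-< (start i) e<2d) (ℕ.≤-reflexive (sym suc-L)))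
      distinct : L ≢ y ⊎ isOver y ≡ false
      distinct with L ℕ.≟ y
      ... | yes L≡y = inj₂ (trans (cong isOver (sym L≡y)) (isOver-plain N))
      ... | no  L≢y = inj₁ L≢y
    continuations : ∀ n′ → ∑< (suc L) (successor m L n′) ≡ closedForm i (suc m) N (staircase i) n′
    continuations n′ = begin
      ∑< (suc L) (successor m L n′)
        ≡⟨ cong (λ c → ∑< c (successor m L n′)) suc-L ⟩
      ∑< (start i + 2 * d) (successor m L n′)
        ≡⟨ ∑<-+ (start i) (2 * d) (successor m L n′) ⟩
      ∑< (start i) (successor m L n′) + ∑< (2 * d) (λ e → successor m L n′ (start i + e))
        ≡⟨ cong₂ _+_ (lowerBlocks m n′ i start<L) (∑<-cong (2 * d) (continuation-open n′)) ⟩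
      ∑< (2 * d) (λ e → gCount k r (suc m) (start i + e) n′)
        ≡⟨ blockSum m over-ok plain-ok i n′ 1≤d d≤w ⟩
      closedForm i (suc m) N (staircase i) n′
        ∎
      where open ≡-Reasoning

  overFormula-suc : ∀ m → OverFormula m → PlainFormula m → OverFormula (suc m)
  overFormula-suc m _       _        zero    n = gCount-invalid-head (suc m) 1 n refl
  overFormula-suc m over-ok plain-ok (suc i) n =
    trans (gCount-via-successors m L n (closedForm i (suc m) (top i) S) (value-over (top i)) continuations)
      (trans (closedForm-prepend i (suc m) (top i) S n)
             (cong (λ s → closedForm (suc i) (suc (suc m)) (top i) s n) (ℕ.+-comm (top i) S)))
    where
    S = staircase i
    L = start (suc i)
    w = width i
    suc-L : suc L ≡ start i + (2 * w + 1)
    suc-L = trans (cong suc (start-suc i))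
                  (trans (sym (ℕ.+-suc (start i) (2 * w))) (cong (start i +_) (ℕ.+-comm 1 (2 * w))))
    last≡L : start i + (2 * w + 0) ≡ L
    last≡L = trans (cong (start i +_) (ℕ.+-identityʳ (2 * w))) (sym (start-suc i))
    start<L : start i < L
    start<L = subst (start i <_) (sym (start-suc i))
                    (ℕ.m<m+n (start i) (ℕ.≤-trans (s≤s z≤n) (ℕ.*-monoʳ-≤ 2 (1≤width i))))
    continuation-open : ∀ n′ e → e < 2 * w →
      successor m L n′ (start i + e) ≡ gCount k r (suc m) (start i + e) n′
    continuation-open n′ e e<2w = successor-open m L n′ (partOK-start i)
      (pairOK-within i (ℕ.m≤m+n (start i) e) (ℕ.<⇒≤ y<L) ℕ.≤-refl (inj₁ (λ L≡y → ℕ.<⇒≢ y<L (sym L≡y))))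
      where
      y<L : start i + e < L
      y<L = ℕ.≤-trans (ℕ.+-monoʳ-< (start i) e<2w) (ℕ.≤-reflexive (sym (start-suc i)))
    continuations : ∀ n′ → ∑< (suc L) (successor m L n′) ≡ closedForm i (suc m) (top i) S n′
    continuations n′ = begin
      ∑< (suc L) f
        ≡⟨ cong (λ c → ∑< c f) suc-L ⟩
      ∑< (start i + (2 * w + 1)) f
        ≡⟨ ∑<-+ (start i) (2 * w + 1) f ⟩
      ∑< (start i) f + ∑< (2 * w + 1) (λ e → f (start i + e))
        ≡⟨ cong₂ _+_ (lowerBlocks m n′ i start<L) (∑<-+ (2 * w) 1 (λ e → f (start i + e))) ⟩
      ∑< (2 * w) (λ e → f (start i + e)) + (f (start i + (2 * w + 0)) + 0)
        ≡⟨ cong₂ _+_ (∑<-cong (2 * w) (continuation-open n′))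
                     (trans (ℕ.+-identityʳ _) (cong f last≡L)) ⟩
      ∑< (2 * w) (λ e → gCount k r (suc m) (start i + e) n′) + f L
        ≡⟨ cong₂ _+_ (blockSum m over-ok plain-ok i n′ (1≤width i) ℕ.≤-refl)
                     (successor-blocked m L n′ (pairOK-repeated L (isOver-over (top i)))) ⟩
      closedForm i (suc m) (base i + w) S n′ + 0
        ≡⟨ ℕ.+-identityʳ _ ⟩
      closedForm i (suc m) (base i + w) S n′
        ≡⟨ cong (λ N → closedForm i (suc m) N S n′) (base+width i) ⟩
      closedForm i (suc m) (top i) S n′
        ∎
      where
      open ≡-Reasoning
      f = successor m L n′

  closedForms : ∀ m → OverFormula m × PlainFormula m
  closedForms zero    = overFormula-one , plainFormula-one
  closedForms (suc m) with closedForms m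
  ... | over-ok , plain-ok = overFormula-suc m over-ok plain-ok , plainFormula-suc m over-ok plain-ok

open import Defs
open import Data.Nat using (ℕ; _≤_; _∸_)
open import Data.Nat.Combinatorics using (_C_)
open import Data.Integer using (ℤ; +_; -_; _+_; _-_; _*_; ∣_∣)
open import Data.Product using (_×_)
open import Data.Sum using (_⊎_)
open import Relation.Binary.PropositionalEquality using (_≡_)
import Data.Nat as N
import Data.Integer as Z

open import Data.Integer using (+≤+)
import Data.Integer.Properties as ℤ
open import Data.Integer.Tactic.RingSolver using (solve-∀)
open import Data.Nat using (zero; suc; z≤n; s≤s)
open import Data.Nat.Combinatorics using (nCk+nC[k+1]≡[n+1]C[k+1]; nC1≡n)
import Data.Nat.Properties as ℕ
import Data.Nat.Tactic.RingSolver as ℕ-Solver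
open import Data.Product using (_,_; proj₁; proj₂)
open import Data.Sum using (inj₁; inj₂)
open import Relation.Binary.PropositionalEquality
  using (refl; sym; trans; cong; cong₂; subst₂; module ≡-Reasoning)

suc-C-2 : ∀ i → suc i C 2 ≡ i C 2 N.+ i
suc-C-2 i = trans (sym (nCk+nC[k+1]≡[n+1]C[k+1] i 1)) (trans (cong (N._+ i C 2) (nC1≡n i)) (ℕ.+-comm i (i C 2)))

+-assoc₃ : ∀ x y z → x + y + z ≡ x + (y + z)
+-assoc₃ = solve-∀

+-assoc₃-pred : ∀ x y z → x + y + z - + 1 ≡ x + (y + z - + 1)
+-assoc₃-pred = solve-∀

module Lemma4p4 (k r′ m′ : ℕ) (r≤k : suc r′ ≤ k) where

  r : ℕ
  r = suc r′

  open Blocks k r (s≤s z≤n) r≤k using (top; base; width; staircase)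
  open ClosedForm k r (s≤s z≤n) r≤k using (closedForms)
  open ShiftedPartitions using (closedForm)
  open Bracket using (IsQPowBracket-resp; closedForm-bracket)

  staircase-C : ∀ i → + staircase i ≡ + k * + (i C 2) + + r * + i
  staircase-C i = trans (cong +_ (ℕ-staircase i)) (cong₂ _+_ (ℤ.pos-* k (i C 2)) (ℤ.pos-* r i))
    where
    ℕ-staircase : ∀ i → staircase i ≡ k N.* (i C 2) N.+ r N.* i
    ℕ-staircase zero    = sym (cong₂ N._+_ (ℕ.*-zeroʳ k) (ℕ.*-zeroʳ r))
    ℕ-staircase (suc i) = trans (cong (N._+ top i) (ℕ-staircase i))
      (trans (step k i r (i C 2)) (cong (λ c → k N.* c N.+ r N.* suc i) (sym (suc-C-2 i))))
      where
      step : ∀ k i r c → k N.* c N.+ r N.* i N.+ (k N.* i N.+ r) ≡ k N.* (c N.+ i) N.+ r N.* suc i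
      step = ℕ-Solver.solve-∀

  overlined : (j : ℕ) → 1 ≤ j →
    IsQPowBracket (gOver k r (suc m′) (k N.* (j ∸ 1) N.+ r))
      ((+ suc m′) - (+ j) + (+ k) * (+ (j C 2)) + (+ r) * (+ j))
      ((+ suc m′) - (+ j) + (+ k) * ((+ j) - + 1) + (+ r) - + 1)
      ((+ k) * ((+ j) - + 1) + (+ r) - + 1)
  overlined (suc i) _ = IsQPowBracket-resp gOver≈closedForm
    (closedForm-bracket (suc i) (suc m′) N (staircase (suc i)) B≡ (+-assoc₃-pred X _ _) e≡)
    where
    X = + suc m′ - + suc i
    N = k N.* i N.+ r′
    gOver≈closedForm : gOver k r (suc m′) (top i)
                         ≈S (λ n → + closedForm (suc i) (suc m′) (suc N) (staircase (suc i)) n)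
    gOver≈closedForm n = cong +_ (trans (proj₁ (closedForms m′) (suc i) n)
      (cong (λ L → closedForm (suc i) (suc m′) L (staircase (suc i)) n) (ℕ.+-suc (k N.* i) r′)))
    B≡ : + k * (+ suc i - + 1) + + r - + 1 ≡ + N
    B≡ = trans (last-top (+ k) (+ i) (+ r′)) (cong (_+ + r′) (sym (ℤ.pos-* k i)))
      where
      last-top : ∀ K I R → K * ((+ 1 + I) - + 1) + (+ 1 + R) - + 1 ≡ K * I + R
      last-top = solve-∀
    e≡ : X + + k * + (suc i C 2) + + r * + suc i ≡ X + + staircase (suc i)
    e≡ = trans (+-assoc₃ X _ _) (cong (_+_ X) (sym (staircase-C (suc i))))

  NonOverlinedClaim : ℕ → ℤ → Set
  NonOverlinedClaim j s =
    IsQPowBracket (gPlain k r (suc m′) ∣ (+ k) * ((+ j) - + 1) + s ∣)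
      ((+ suc m′) - (+ j) + (+ k) * (+ (j C 2)) + (+ r) * ((+ j) - + 1) + s)
      ((+ suc m′) - (+ j) + (+ k) * ((+ j) - + 1) + s - + 1)
      ((+ k) * ((+ j) - + 1) + s - + 1)

  nonOverlined-block : ∀ i {d} (s : ℤ) → 1 ≤ d → d ≤ width i →
    + k * (+ suc i - + 1) + s ≡ + (base i N.+ d) → NonOverlinedClaim (suc i) s
  nonOverlined-block i {suc d′} s 1≤d d≤w value≡ = IsQPowBracket-resp gPlain≈closedForm
    (closedForm-bracket (suc i) (suc m′) N (v N.+ staircase i) B≡ (+-assoc₃-pred X _ _) e≡)
    where
    X = + suc m′ - + suc i
    v = base i N.+ suc d′
    N = base i N.+ d′
    gPlain≈closedForm : gPlain k r (suc m′) ∣ + k * (+ suc i - + 1) + s ∣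
                          ≈S (λ n → + closedForm (suc i) (suc m′) (suc N) (v N.+ staircase i) n)
    gPlain≈closedForm n = cong +_ (trans (cong (λ x → gCount k r (suc m′) (plain ∣ x ∣) n) value≡)
      (trans (proj₂ (closedForms m′) i n 1≤d d≤w)
             (cong (λ L → closedForm (suc i) (suc m′) L (v N.+ staircase i) n) (ℕ.+-suc (base i) d′))))
    B≡ : + k * (+ suc i - + 1) + s - + 1 ≡ + N
    B≡ = trans (cong (_- + 1) value≡) (cong (λ x → + x - + 1) (ℕ.+-suc (base i) d′))
    e≡ : X + + k * + (suc i C 2) + + r * (+ suc i - + 1) + s ≡ X + + (v N.+ staircase i)
    e≡ = begin
      X + + k * + (suc i C 2) + + r * (+ suc i - + 1) + s
        ≡⟨ cong (λ c → X + + k * + c + + r * (+ suc i - + 1) + s) (suc-C-2 i) ⟩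
      X + + k * (+ (i C 2) + + i) + + r * (+ suc i - + 1) + s
        ≡⟨ regroup X (+ k) (+ i) (+ r) (+ (i C 2)) s ⟩
      X + ((+ k * (+ suc i - + 1) + s) + (+ k * + (i C 2) + + r * + i))
        ≡⟨ cong₂ (λ a b → X + (a + b)) value≡ (sym (staircase-C i)) ⟩
      X + (+ v + + staircase i)
        ∎
      where
      open ≡-Reasoning
      regroup : ∀ X K I R C S →
        X + K * (C + I) + R * ((+ 1 + I) - + 1) + S ≡ X + ((K * ((+ 1 + I) - + 1) + S) + (K * C + R * I))
      regroup = solve-∀

  nonOverlined : (j : ℕ) (s : ℤ) →
    ((j ≡ 1 × (+ 1 Z.≤ s) × (s Z.≤ + r))
      ⊎ ((2 ≤ j) × ((- (+ k)) + (+ r) + (+ 1) Z.≤ s) × (s Z.≤ + r))) →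
    NonOverlinedClaim j s
  nonOverlined .1 (+ d) (inj₁ (refl , +≤+ 1≤d , +≤+ d≤r)) =
    nonOverlined-block 0 (+ d) 1≤d d≤r (first-block (+ k) (+ d))
    where
    first-block : ∀ K D → K * (+ 1 - + 1) + D ≡ D
    first-block = solve-∀
  nonOverlined (suc zero)    s (inj₂ (s≤s () , _))
  nonOverlined (suc (suc i)) s (inj₂ (_ , lo , hi)) =
    in-block (s + + k - + r) refl (subst₂ Z._≤_ (cancel₁ (+ k) (+ r)) (swap (+ k) (+ r) s) (shift lo))
                                  (subst₂ Z._≤_ (swap (+ k) (+ r) s) (cancel₂ (+ k) (+ r)) (shift hi))
    where
    -- the part k(j-1)+s of block j = i+2 is base (i+1) + d with d = s + k - r
    in-block : ∀ t → t ≡ s + + k - + r → + 1 Z.≤ t → t Z.≤ + k → NonOverlinedClaim (suc (suc i)) s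
    in-block (+ d) t≡ (+≤+ 1≤d) (+≤+ d≤k) = nonOverlined-block (suc i) s 1≤d d≤k
      (trans (split (+ k) (+ i) (+ r) s) (cong₂ _+_ (cong (_+ + r) (sym (ℤ.pos-* k i))) (sym t≡)))
      where
      split : ∀ K I R S → K * ((+ 1 + (+ 1 + I)) - + 1) + S ≡ (K * I + R) + (S + K - R)
      split = solve-∀
    shift : ∀ {x y} → x Z.≤ y → (+ k - + r) + x Z.≤ (+ k - + r) + y
    shift = ℤ.+-monoʳ-≤ (+ k - + r)
    swap : ∀ K R S → K - R + S ≡ S + K - R
    swap = solve-∀
    cancel₁ : ∀ K R → K - R + (- K + R + + 1) ≡ + 1
    cancel₁ = solve-∀
    cancel₂ : ∀ K R → K - R + R ≡ K
    cancel₂ = solve-∀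

lemma4p4 : (k r m : ℕ) → 1 ≤ r → r ≤ k → 1 ≤ m →
    ((j : ℕ) → 1 ≤ j →
      IsQPowBracket (gOver k r m (k N.* (j ∸ 1) N.+ r))
        ((+ m) - (+ j) + (+ k) * (+ (j C 2)) + (+ r) * (+ j))
        ((+ m) - (+ j) + (+ k) * ((+ j) - + 1) + (+ r) - + 1)
        ((+ k) * ((+ j) - + 1) + (+ r) - + 1))
    ×
    ((j : ℕ) (s : ℤ) →
      ((j ≡ 1 × (+ 1 Z.≤ s) × (s Z.≤ + r))
        ⊎ ((2 ≤ j) × ((- (+ k)) + (+ r) + (+ 1) Z.≤ s) × (s Z.≤ + r))) →
      IsQPowBracket (gPlain k r m ∣ (+ k) * ((+ j) - + 1) + s ∣)
        ((+ m) - (+ j) + (+ k) * (+ (j C 2)) + (+ r) * ((+ j) - + 1) + s)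
        ((+ m) - (+ j) + (+ k) * ((+ j) - + 1) + s - + 1)
        ((+ k) * ((+ j) - + 1) + s - + 1))
lemma4p4 k (suc r′) (suc m′) _ r≤k _ =
  Lemma4p4.overlined k r′ m′ r≤k , Lemma4p4.nonOverlined k r′ m′ r≤k
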